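{- Let $p$ be a prime with $p-1=2^iq_1^{j_1}q_2^{j_2}$, where $q_1\neq q_2$ are odd primes and $i,j_1,j_2\ge 1$. Suppose every connected component of the digraph $D$ of missing generators has $n$ vertices. Then: if $n$ is even, $2^n\equiv \pm1\pmod{q_1q_2}$; if $n$ is odd, $2^{n-1}\equiv \pm x_1^{ -1}\pmod{q_1q_2}$.
   Context: $\mathcal{G}$ is the set of generators of $\mathbb{Z}_p^*$, $\mathcal{R}$ the set of quadratic residues in $\mathbb{Z}_p^*$. For $g\in\mathcal{G}$: $\mathcal{R}_g=\{r\in\mathcal{R}: gr\in\mathcal{G}\}$, $\mathcal{I}(g)=\mathcal{R}_g\cap\mathcal{R}_{g^{ -1}}$, $\mathcal{M}(g)=\mathcal{G}\setminus\{gr,\ g^{ -1}r : r\in\mathcal{I}(g)\}$ (products mod $p$). The digraph $D$ has vertex set $\{\mathcal{M}(g): g\in\mathcal{G}\}$ and a directed edge from $\mathcal{M}(g)$ to $\mathcal{M}(h)$ whenever $h\in\mathcal{M}(g)$. The congruence $x^2\equiv 4\pmod{q_1q_2}$ has exactly two solutions $x\in\{1,\dots,q_1q_2-1\}$ other than $2$ and $q_1q_2-2$; they sum to $q_1q_2$, and $x_1$ denotes the odd one. $x_1^{ -1}$ is its inverse modulo $q_1q_2$, and "$\equiv\pm a$" means congruent to $a$ or to $-a$. -}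

module Defs where

open import Data.Nat using (ℕ; suc; _+_; _*_; _∸_; _^_; _≤_; _<_)
open import Data.Product using (Σ; ∃; ∃-syntax; _×_)
open import Data.Sum using (_⊎_)
open import Data.List using (List; length)
open import Data.List.Relation.Unary.All using (All)
open import Data.List.Relation.Unary.Any using (Any)
open import Data.List.Relation.Unary.AllPairs using (AllPairs)
open import Relation.Nullary using (¬_)
open import Relation.Binary.PropositionalEquality using (_≡_)
open import Relation.Binary.Construct.Closure.Equivalence using (EqClosure)

infix 4 _≡_[mod_]
_≡_[mod_] : ℕ → ℕ → ℕ → Set
a ≡ b [mod m ] = (∃[ k ] a ≡ b + k * m) ⊎ (∃[ k ] b ≡ a + k * m)

-- elements of ℤ_p^* are represented by 1, …, p-1
InUnits : ℕ → ℕ → Set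
InUnits p x = 1 ≤ x × x < p

IsGen : ℕ → ℕ → Set
IsGen p g = InUnits p g × (∀ x → InUnits p x → ∃[ k ] (g ^ k ≡ x [mod p ]))

IsQR : ℕ → ℕ → Set
IsQR p r = InUnits p r × (∃[ y ] (y * y ≡ r [mod p ]))

IsInv : ℕ → ℕ → ℕ → Set
IsInv p g h = InUnits p h × (g * h ≡ 1 [mod p ])

InRg : ℕ → ℕ → ℕ → Set
InRg p g r = IsQR p r × (∃[ x ] (IsGen p x × x ≡ g * r [mod p ]))

InI : ℕ → ℕ → ℕ → Set
InI p g r = InRg p g r × (∃[ h ] (IsInv p g h × InRg p h r))

InM : ℕ → ℕ → ℕ → Set
InM p g x =
  IsGen p x ×
  ¬ (∃[ r ] (InI p g r ×
       (x ≡ g * r [mod p ] ⊎ (∃[ h ] (IsInv p g h × x ≡ h * r [mod p ])))))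

-- ℳ(g) and ℳ(g') are the same vertex of D (equal as sets)
SameM : ℕ → ℕ → ℕ → Set
SameM p g g' = ∀ x → (InM p g x → InM p g' x) × (InM p g' x → InM p g x)

-- directed edge ℳ(g) → ℳ(h) of D, for generators g h:
-- h' ∈ ℳ(g) for some generator h' with ℳ(h') = ℳ(h)
Edge : ℕ → ℕ → ℕ → Set
Edge p g h = IsGen p g × IsGen p h × (∃[ h' ] (IsGen p h' × SameM p h' h × InM p g h'))

Conn : ℕ → ℕ → ℕ → Set
Conn p = EqClosure (Edge p)

ComponentSize : ℕ → ℕ → ℕ → Set
ComponentSize p g n =
  ∃[ hs ] ( All (λ h → IsGen p h × Conn p g h) hs
          × AllPairs (λ a b → ¬ SameM p a b) hs
          × (∀ h → IsGen p h → Conn p g h → Any (λ h' → SameM p h h') hs)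
          × length hs ≡ n )

Odd : ℕ → Set
Odd m = ∃[ k ] m ≡ suc (2 * k)

{-# OPTIONS --safe #-}
module Submission where

-- A primitive root ω exists: each prime power ℓ ^ e exactly dividing p - 1 is the order of
-- some x ^ M, because Fermat gives x ^ (p - 1) ≡ 1 while a finite-difference argument shows that
-- X ^ ((p - 1) / ℓ) - 1 cannot vanish on all units.  The generators are then the ω ^ c with c prime
-- to p - 1, and unwinding ℛ_g, ℐ(g) and ℳ(g) in exponents shows, for g = ω ^ a, that ℳ(g) is the set
-- of generators ω ^ c with c ≡ ±x₁ a (mod q₁q₂), where x₁ ≡ 2 modulo one qᵢ and ≡ -2 modulo the other.
-- So ℳ(g) = ℳ(g′) iff the exponents agree up to sign modulo q₁q₂, every edge multiplies exponents
-- by ±x₁, and the component of ω has as many vertices as the period n of x₁ modulo q₁q₂ up to sign: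
-- x₁ ^ n ≡ ±1.  With x₁ ^ 2 ≡ 4 this reads 2 ^ n ≡ ±1 for even n and x₁ 2 ^ (n - 1) ≡ ±1 for odd n.

module ModularArithmetic where

  open import Data.Nat.Base
  open import Data.Nat.Properties
  open import Data.Nat.Divisibility
  open import Data.Nat.DivMod using (_%_; _/_; m≡m%n+[m/n]*n; m%n<n)
  open import Data.Nat.Primality using (Prime; euclidsLemma; prime⇒irreducible; ¬prime[1])
  open import Data.Nat.Coprimality as Coprimality using (Coprime; coprime-divisor)
  open import Data.Integer.Base as ℤ using (ℤ; +_; -[1+_])
  import Data.Integer.Properties as ℤₚ
  import Data.Integer.Divisibility.Signed as ℤ∣
  open import Data.Integer.Tactic.RingSolver using (solve-∀)
  open import Data.Product.Base using (_,_)
  open import Data.Sum.Base using (_⊎_; inj₁; inj₂; map)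
  open import Function.Base using (_∘_)
  open import Relation.Binary.Bundles using (Setoid)
  open import Relation.Binary.Structures using (IsEquivalence)
  open import Relation.Nullary using (¬_; Dec; map′; contradiction)
  open import Relation.Binary.PropositionalEquality
  open import Defs using (_≡_[mod_])

  coprime-*ˡ : ∀ {m n o} → Coprime m o → Coprime n o → Coprime (m * n) o
  coprime-*ˡ {m} {n} m⊥o n⊥o (d∣mn , d∣o) = n⊥o (coprime-divisor d⊥m d∣mn , d∣o)
    where
    d⊥m : Coprime _ m
    d⊥m (e∣d , e∣m) = m⊥o (e∣m , ∣-trans e∣d d∣o)

  coprime-^ˡ : ∀ {m o} → Coprime m o → ∀ e → Coprime (m ^ e) o
  coprime-^ˡ m⊥o zero    (d∣1 , _) = ∣1⇒≡1 d∣1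
  coprime-^ˡ m⊥o (suc e) = coprime-*ˡ m⊥o (coprime-^ˡ m⊥o e)

  prime∤⇒coprime : ∀ {ℓ b} → Prime ℓ → ¬ ℓ ∣ b → Coprime ℓ b
  prime∤⇒coprime pℓ ℓ∤b (d∣ℓ , d∣b) with prime⇒irreducible pℓ d∣ℓ
  ... | inj₁ d≡1 = d≡1
  ... | inj₂ refl = contradiction d∣b ℓ∤b

  prime∣prime : ∀ {ℓ r} → Prime ℓ → Prime r → ℓ ∣ r → ℓ ≡ r
  prime∣prime pℓ pr ℓ∣r with prime⇒irreducible pr ℓ∣r
  ... | inj₁ refl = contradiction pℓ ¬prime[1]
  ... | inj₂ ℓ≡r  = ℓ≡r

  primes-coprime : ∀ {ℓ r} → Prime ℓ → Prime r → ℓ ≢ r → Coprime ℓ r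
  primes-coprime pℓ pr ℓ≢r = prime∤⇒coprime pℓ (ℓ≢r ∘ prime∣prime pℓ pr)

  coprime-^ : ∀ {m n} → Coprime m n → ∀ a b → Coprime (m ^ a) (n ^ b)
  coprime-^ m⊥n a b = Coprimality.sym (coprime-^ˡ (Coprimality.sym (coprime-^ˡ m⊥n a)) b)

  coprime⇒*∣ : ∀ {m n o} → Coprime m n → m ∣ o → n ∣ o → m * n ∣ o
  coprime⇒*∣ {m} {n} m⊥n (divides k refl) n∣km with coprime-divisor (Coprimality.sym m⊥n) (subst (n ∣_) (*-comm k m) n∣km)
  ... | divides j refl = divides j (trans (*-assoc j n m) (cong (j *_) (*-comm n m)))

  infix 4 _≈_[mod_]
  record _≈_[mod_] (a b m : ℕ) : Set where
    constructor mk≈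
    field modulus∣difference : + m ℤ∣.∣ + a ℤ.- + b
  open _≈_[mod_] public

  module _ {m : ℕ} where

    ≈-refl : ∀ {a} → a ≈ a [mod m ]
    ≈-refl {a} = mk≈ (ℤ∣.divides ℤ.0ℤ (ℤₚ.+-inverseʳ (+ a)))

    ≈-reflexive : ∀ {a b} → a ≡ b → a ≈ b [mod m ]
    ≈-reflexive refl = ≈-refl

    ≈-sym : ∀ {a b} → a ≈ b [mod m ] → b ≈ a [mod m ]
    ≈-sym {a} {b} (mk≈ d) = mk≈ (subst (_ ℤ∣.∣_) (negate (+ a) (+ b)) (ℤ∣.∣m⇒∣-m d))
      where
      negate : ∀ x y → ℤ.- (x ℤ.- y) ≡ y ℤ.- x
      negate = solve-∀

    ≈-trans : ∀ {a b c} → a ≈ b [mod m ] → b ≈ c [mod m ] → a ≈ c [mod m ]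
    ≈-trans {a} {b} {c} (mk≈ d) (mk≈ e) =
      mk≈ (subst (_ ℤ∣.∣_) (telescope (+ a) (+ b) (+ c)) (ℤ∣.∣m∣n⇒∣m+n d e))
      where
      telescope : ∀ x y z → (x ℤ.- y) ℤ.+ (y ℤ.- z) ≡ x ℤ.- z
      telescope = solve-∀

    ≈-isEquivalence : IsEquivalence (_≈_[mod m ])
    ≈-isEquivalence = record { refl = ≈-refl ; sym = ≈-sym ; trans = ≈-trans }

  ≈-setoid : ℕ → Setoid _ _
  ≈-setoid m = record { isEquivalence = ≈-isEquivalence {m} }

  module ≈-Reasoning (m : ℕ) where
    open import Relation.Binary.Reasoning.Setoid (≈-setoid m) public

  module _ {m : ℕ} where

    private
      by : ∀ {a b z} → z ≡ + a ℤ.- + b → + m ℤ∣.∣ z → a ≈ b [mod m ]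
      by eq d = mk≈ (subst (_ ℤ∣.∣_) eq d)

    +-cong : ∀ {a b c d} → a ≈ b [mod m ] → c ≈ d [mod m ] → a + c ≈ b + d [mod m ]
    +-cong {a} {b} {c} {d} (mk≈ x) (mk≈ y) = by eq (ℤ∣.∣m∣n⇒∣m+n x y)
      where
      regroup : ∀ a b c d → (a ℤ.- b) ℤ.+ (c ℤ.- d) ≡ (a ℤ.+ c) ℤ.- (b ℤ.+ d)
      regroup = solve-∀
      eq : (+ a ℤ.- + b) ℤ.+ (+ c ℤ.- + d) ≡ + (a + c) ℤ.- + (b + d)
      eq = trans (regroup (+ a) (+ b) (+ c) (+ d)) (sym (cong₂ ℤ._-_ (ℤₚ.pos-+ a c) (ℤₚ.pos-+ b d)))

    +-congˡ : ∀ {a b} c → a ≈ b [mod m ] → c + a ≈ c + b [mod m ]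
    +-congˡ c = +-cong (≈-refl {a = c})

    +-congʳ : ∀ {a b} c → a ≈ b [mod m ] → a + c ≈ b + c [mod m ]
    +-congʳ c e = +-cong e (≈-refl {a = c})

    +-cancelʳ : ∀ {a b} c → a + c ≈ b + c [mod m ] → a ≈ b [mod m ]
    +-cancelʳ {a} {b} c (mk≈ x) = by eq x
      where
      cancel : ∀ a b c → (a ℤ.+ c) ℤ.- (b ℤ.+ c) ≡ a ℤ.- b
      cancel = solve-∀
      eq : + (a + c) ℤ.- + (b + c) ≡ + a ℤ.- + b
      eq = trans (cong₂ ℤ._-_ (ℤₚ.pos-+ a c) (ℤₚ.pos-+ b c)) (cancel (+ a) (+ b) (+ c))

    *-cong : ∀ {a b c d} → a ≈ b [mod m ] → c ≈ d [mod m ] → a * c ≈ b * d [mod m ]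
    *-cong {a} {b} {c} {d} (mk≈ x) (mk≈ y) = by eq (ℤ∣.∣m∣n⇒∣m+n (ℤ∣.∣n⇒∣m*n (+ a) y) (ℤ∣.∣n⇒∣m*n (+ d) x))
      where
      expand : ∀ a b c d → a ℤ.* (c ℤ.- d) ℤ.+ d ℤ.* (a ℤ.- b) ≡ a ℤ.* c ℤ.- b ℤ.* d
      expand = solve-∀
      eq : + a ℤ.* (+ c ℤ.- + d) ℤ.+ + d ℤ.* (+ a ℤ.- + b) ≡ + (a * c) ℤ.- + (b * d)
      eq = trans (expand (+ a) (+ b) (+ c) (+ d)) (sym (cong₂ ℤ._-_ (ℤₚ.pos-* a c) (ℤₚ.pos-* b d)))

    *-congˡ : ∀ {a b} c → a ≈ b [mod m ] → c * a ≈ c * b [mod m ]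
    *-congˡ c = *-cong (≈-refl {a = c})

    *-congʳ : ∀ {a b} c → a ≈ b [mod m ] → a * c ≈ b * c [mod m ]
    *-congʳ c e = *-cong e (≈-refl {a = c})

    ^-congˡ : ∀ {a b} k → a ≈ b [mod m ] → a ^ k ≈ b ^ k [mod m ]
    ^-congˡ zero    e = ≈-refl
    ^-congˡ (suc k) e = *-cong e (^-congˡ k e)

    +-multiple : ∀ a k → a + k * m ≈ a [mod m ]
    +-multiple a k = by eq (ℤ∣.divides (+ k) refl)
      where
      shift : ∀ a t → (a ℤ.+ t) ℤ.- a ≡ t
      shift = solve-∀
      eq : + k ℤ.* + m ≡ + (a + k * m) ℤ.- + a
      eq = sym (trans (cong (λ z → z ℤ.- + a) (trans (ℤₚ.pos-+ a (k * m)) (cong (ℤ._+_ (+ a)) (ℤₚ.pos-* k m)))) (shift (+ a) _))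

    ∣⇒≈0 : ∀ {a} → m ∣ a → a ≈ 0 [mod m ]
    ∣⇒≈0 (divides k refl) = +-multiple 0 k

    ≈0⇒∣ : ∀ {a} → a ≈ 0 [mod m ] → m ∣ a
    ≈0⇒∣ {a} (mk≈ d) = subst (λ z → m ∣ ℤ.∣ z ∣) (ℤₚ.+-identityʳ (+ a)) (ℤ∣.∣⇒∣ᵤ d)

    ≡mod⇒≈ : ∀ {a b} → a ≡ b [mod m ] → a ≈ b [mod m ]
    ≡mod⇒≈ (inj₁ (k , refl)) = +-multiple _ k
    ≡mod⇒≈ (inj₂ (k , refl)) = ≈-sym (+-multiple _ k)

    ≈⇒≡mod : ∀ {a b} → a ≈ b [mod m ] → a ≡ b [mod m ]
    ≈⇒≡mod {a} {b} (mk≈ (ℤ∣.divides (+ k) eq)) =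
      inj₁ (k , ℤₚ.+-injective (begin
        + a                        ≡⟨ split (+ a) (+ b) ⟩
        + b ℤ.+ (+ a ℤ.- + b)      ≡⟨ cong (ℤ._+_ (+ b)) eq ⟩
        + b ℤ.+ + k ℤ.* + m        ≡⟨ cong (ℤ._+_ (+ b)) (ℤₚ.pos-* k m) ⟨
        + b ℤ.+ + (k * m)          ≡⟨ ℤₚ.pos-+ b (k * m) ⟨
        + (b + k * m)              ∎))
      where
      open ≡-Reasoning
      split : ∀ a b → a ≡ b ℤ.+ (a ℤ.- b)
      split = solve-∀
    ≈⇒≡mod {a} {b} (mk≈ (ℤ∣.divides -[1+ k ] eq)) =
      inj₂ (suc k , ℤₚ.+-injective (begin
        + b                                 ≡⟨ split (+ a) (+ b) ⟩
        + a ℤ.- (+ a ℤ.- + b)               ≡⟨ cong (ℤ._-_ (+ a)) eq ⟩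
        + a ℤ.- -[1+ k ] ℤ.* + m            ≡⟨ cong (ℤ._+_ (+ a)) (ℤₚ.neg-distribˡ-* -[1+ k ] (+ m)) ⟩
        + a ℤ.+ + suc k ℤ.* + m             ≡⟨ cong (ℤ._+_ (+ a)) (ℤₚ.pos-* (suc k) m) ⟨
        + a ℤ.+ + (suc k * m)               ≡⟨ ℤₚ.pos-+ a (suc k * m) ⟨
        + (a + suc k * m)                   ∎))
      where
      open ≡-Reasoning
      split : ∀ a b → b ≡ a ℤ.- (a ℤ.- b)
      split = solve-∀

    ≈-divisor : ∀ {n a b} → n ∣ m → a ≈ b [mod m ] → a ≈ b [mod n ]
    ≈-divisor n∣m (mk≈ d) = mk≈ (ℤ∣.∣-trans (ℤ∣.∣ᵤ⇒∣ n∣m) d)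

  m%n≈m : ∀ a m .{{_ : NonZero m}} → a % m ≈ a [mod m ]
  m%n≈m a m = subst (λ x → a % m ≈ x [mod m ]) (sym (m≡m%n+[m/n]*n a m)) (≈-sym (+-multiple (a % m) (a / m)))

  infix 4 _≈?_[mod_]
  _≈?_[mod_] : ∀ a b m → Dec (a ≈ b [mod m ])
  a ≈? b [mod m ] = map′ (mk≈ ∘ ℤ∣.∣ᵤ⇒∣) (ℤ∣.∣⇒∣ᵤ ∘ modulus∣difference) (m ∣? ℤ.∣ + a ℤ.- + b ∣)

  private
    prime-∣-* : ∀ {p} → Prime p → ∀ u v → + p ℤ∣.∣ u ℤ.* v → + p ℤ∣.∣ u ⊎ + p ℤ∣.∣ v
    prime-∣-* pp u v d =
      map ℤ∣.∣ᵤ⇒∣ ℤ∣.∣ᵤ⇒∣ (euclidsLemma ℤ.∣ u ∣ ℤ.∣ v ∣ pp (subst (_ ∣_) (ℤₚ.abs-* u v) (ℤ∣.∣⇒∣ᵤ d)))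

  *-cancelˡ-prime : ∀ {p x a b} → Prime p → ¬ p ∣ x → x * a ≈ x * b [mod p ] → a ≈ b [mod p ]
  *-cancelˡ-prime {p} {x} {a} {b} pp p∤x (mk≈ d) with prime-∣-* pp (+ x) (+ a ℤ.- + b) (subst (_ ℤ∣.∣_) eq d)
    where
    factor : ∀ x a b → x ℤ.* a ℤ.- x ℤ.* b ≡ x ℤ.* (a ℤ.- b)
    factor = solve-∀
    eq : + (x * a) ℤ.- + (x * b) ≡ + x ℤ.* (+ a ℤ.- + b)
    eq = trans (cong₂ ℤ._-_ (ℤₚ.pos-* x a) (ℤₚ.pos-* x b)) (factor (+ x) (+ a) (+ b))
  ... | inj₁ p∣x = contradiction (ℤ∣.∣⇒∣ᵤ p∣x) p∤x
  ... | inj₂ p∣a-b = mk≈ p∣a-b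

  ≈-*-coprime : ∀ {m n a b} → Coprime m n → a ≈ b [mod m ] → a ≈ b [mod n ] → a ≈ b [mod m * n ]
  ≈-*-coprime m⊥n (mk≈ d) (mk≈ e) = mk≈ (ℤ∣.∣ᵤ⇒∣ (coprime⇒*∣ m⊥n (ℤ∣.∣⇒∣ᵤ d) (ℤ∣.∣⇒∣ᵤ e)))

  infix 4 _≈±_[mod_]
  _≈±_[mod_] : ℕ → ℕ → ℕ → Set
  a ≈± b [mod m ] = a ≈ b [mod m ] ⊎ a + b ≈ 0 [mod m ]

  module _ {m : ℕ} where

    ≈⇒≈± : ∀ {a b} → a ≈ b [mod m ] → a ≈± b [mod m ]
    ≈⇒≈± = inj₁

    ≈±-refl : ∀ {a} → a ≈± a [mod m ]
    ≈±-refl = inj₁ ≈-refl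

    ≈±-sym : ∀ {a b} → a ≈± b [mod m ] → b ≈± a [mod m ]
    ≈±-sym (inj₁ e)           = inj₁ (≈-sym e)
    ≈±-sym {a} {b} (inj₂ e) = inj₂ (≈-trans (≈-reflexive (+-comm b a)) e)

    ≈±-trans : ∀ {a b c} → a ≈± b [mod m ] → b ≈± c [mod m ] → a ≈± c [mod m ]
    ≈±-trans (inj₁ e) (inj₁ f) = inj₁ (≈-trans e f)
    ≈±-trans (inj₁ e) (inj₂ f) = inj₂ (≈-trans (+-congʳ _ e) f)
    ≈±-trans (inj₂ e) (inj₁ f) = inj₂ (≈-trans (+-congˡ _ (≈-sym f)) e)
    ≈±-trans {a} {b} {c} (inj₂ e) (inj₂ f) =
      inj₁ (+-cancelʳ b (≈-trans e (≈-sym (≈-trans (≈-reflexive (+-comm c b)) f))))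

    ≈±-*-cong : ∀ {a b c d} → a ≈± b [mod m ] → c ≈± d [mod m ] → a * c ≈± b * d [mod m ]
    ≈±-*-cong (inj₁ e) (inj₁ f) = inj₁ (*-cong e f)
    ≈±-*-cong {a} {b} {c} {d} (inj₁ e) (inj₂ f) = inj₂ (begin
      a * c + b * d ≈⟨ +-congʳ (b * d) (*-congʳ c e) ⟩
      b * c + b * d ≡⟨ *-distribˡ-+ b c d ⟨
      b * (c + d)   ≈⟨ *-congˡ b f ⟩
      b * 0         ≡⟨ *-zeroʳ b ⟩
      0             ∎)
      where open ≈-Reasoning m
    ≈±-*-cong {a} {b} {c} {d} (inj₂ e) (inj₁ f) = inj₂ (begin
      a * c + b * d ≈⟨ +-congʳ (b * d) (*-congˡ a f) ⟩
      a * d + b * d ≡⟨ *-distribʳ-+ d a b ⟨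
      (a + b) * d   ≈⟨ *-congʳ d e ⟩
      0             ∎)
      where open ≈-Reasoning m
    ≈±-*-cong {a} {b} {c} {d} (inj₂ e) (inj₂ f) = inj₁ (+-cancelʳ (b * c) (begin
      a * c + b * c ≡⟨ *-distribʳ-+ c a b ⟨
      (a + b) * c   ≈⟨ *-congʳ c e ⟩
      0             ≡⟨ *-zeroʳ b ⟨
      b * 0         ≈⟨ *-congˡ b f ⟨
      b * (c + d)   ≡⟨ trans (*-distribˡ-+ b c d) (+-comm (b * c) (b * d)) ⟩
      b * d + b * c ∎))
      where open ≈-Reasoning m

    ≈±-*-congˡ : ∀ {a b} c → a ≈± b [mod m ] → c * a ≈± c * b [mod m ]
    ≈±-*-congˡ c = ≈±-*-cong (≈±-refl {a = c})

  *≈*⇒≈± : ∀ {q a b} → Prime q → a * a ≈ b * b [mod q ] → a ≈± b [mod q ]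
  *≈*⇒≈± {q} {a} {b} pq (mk≈ d) with prime-∣-* pq (+ a ℤ.- + b) (+ a ℤ.+ + b) (subst (_ ℤ∣.∣_) eq d)
    where
    factor : ∀ a b → a ℤ.* a ℤ.- b ℤ.* b ≡ (a ℤ.- b) ℤ.* (a ℤ.+ b)
    factor = solve-∀
    eq : + (a * a) ℤ.- + (b * b) ≡ (+ a ℤ.- + b) ℤ.* (+ a ℤ.+ + b)
    eq = trans (cong₂ ℤ._-_ (ℤₚ.pos-* a a) (ℤₚ.pos-* b b)) (factor (+ a) (+ b))
  ... | inj₁ e = inj₁ (mk≈ e)
  ... | inj₂ f = inj₂ (mk≈ (subst (+ q ℤ∣.∣_) (sym (trans (ℤₚ.+-identityʳ _) (ℤₚ.pos-+ a b))) f))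

  private
    no-wrap : ∀ {m b} k → b + k * m < m → b + k * m ≡ b
    no-wrap     zero    _  = +-identityʳ _
    no-wrap {m} {b} (suc k) lt = contradiction lt (≤⇒≯ (≤-trans (m≤m+n m (k * m)) (m≤n+m _ b)))

  ≈∧<⇒≡ : ∀ {m a b} → a < m → b < m → a ≈ b [mod m ] → a ≡ b
  ≈∧<⇒≡ a<m b<m a≈b with ≈⇒≡mod a≈b
  ... | inj₁ (k , refl) = no-wrap k a<m
  ... | inj₂ (k , refl) = sym (no-wrap k b<m)

  *≈1⇒coprime : ∀ {n c t} → c * t ≈ 1 [mod n ] → Coprime n c
  *≈1⇒coprime {c = c} {t} ct≈1 (d∣n , d∣c) =
    ∣1⇒≡1 (≈0⇒∣ (≈-trans (≈-sym (≈-divisor d∣n ct≈1)) (∣⇒≈0 (∣m⇒∣m*n t d∣c))))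

  coprime-≈ : ∀ {n u v} → u ≈ v [mod n ] → Coprime n u → Coprime n v
  coprime-≈ u≈v n⊥u (d∣n , d∣v) = n⊥u (d∣n , ≈0⇒∣ (≈-trans (≈-divisor d∣n u≈v) (∣⇒≈0 d∣v)))

  odd⇒≈1 : ∀ {c} → ¬ 2 ∣ c → c ≈ 1 [mod 2 ]
  odd⇒≈1 {c} 2∤c = ≈-trans (≈-sym (m%n≈m c 2)) (≈-reflexive (residue (c % 2) (m%n<n c 2) (2∤c ∘ m%n≡0⇒n∣m c 2)))
    where
    residue : ∀ r → r < 2 → r ≢ 0 → r ≡ 1
    residue zero          _                 r≢0 = contradiction refl r≢0
    residue (suc zero)    _                 _   = refl
    residue (suc (suc r)) (s≤s (s≤s ()))    _

  ≈1⇒odd : ∀ {c} → c ≈ 1 [mod 2 ] → ¬ 2 ∣ c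
  ≈1⇒odd c≈1 2∣c with ∣1⇒≡1 (≈0⇒∣ (≈-trans (≈-sym c≈1) (∣⇒≈0 2∣c)))
  ... | ()

  +≈0⇒≈ : ∀ {m u v c} → u + v ≈ 0 [mod m ] → c + u ≈ 0 [mod m ] → c ≈ v [mod m ]
  +≈0⇒≈ {u = u} {v} u+v≈0 c+u≈0 = +-cancelʳ u (≈-trans c+u≈0 (≈-sym (≈-trans (≈-reflexive (+-comm v u)) u+v≈0)))

  ≈⇒+≈0 : ∀ {m u v c} → u + v ≈ 0 [mod m ] → c ≈ v [mod m ] → c + u ≈ 0 [mod m ]
  ≈⇒+≈0 {u = u} {v} u+v≈0 c≈v = ≈-trans (+-congʳ u c≈v) (≈-trans (≈-reflexive (+-comm v u)) u+v≈0)

  ≈±-resp : ∀ {m a b c d} → a ≈ c [mod m ] → b ≈ d [mod m ] → a ≈± b [mod m ] → c ≈± d [mod m ]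
  ≈±-resp a≈c b≈d a≈±b = ≈±-trans (≈⇒≈± (≈-sym a≈c)) (≈±-trans a≈±b (≈⇒≈± b≈d))

  ≈±⇒*≈* : ∀ {q a b} → a ≈± b [mod q ] → a * a ≈ b * b [mod q ]
  ≈±⇒*≈* (inj₁ a≈b) = *-cong a≈b a≈b
  ≈±⇒*≈* {q} {a} {b} (inj₂ a+b≈0) = +-cancelʳ (a * b) (begin
    a * a + a * b   ≡⟨ *-distribˡ-+ a a b ⟨
    a * (a + b)     ≈⟨ *-congˡ a a+b≈0 ⟩
    a * 0           ≡⟨ *-zeroʳ a ⟩
    0               ≡⟨ *-zeroʳ b ⟨
    b * 0           ≈⟨ *-congˡ b a+b≈0 ⟨
    b * (a + b)     ≡⟨ trans (*-distribˡ-+ b a b) (trans (+-comm (b * a) (b * b)) (cong (_+_ (b * b)) (*-comm b a))) ⟩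
    b * b + a * b   ∎)
    where open ≈-Reasoning q

module Fermat where

  open import Data.Nat.Base
  open import Data.Nat.Properties
  open import Data.Nat.Divisibility
  open import Data.Nat.DivMod using (m/n*n≡m)
  open import Data.Nat.Primality using (Prime; euclidsLemma; prime⇒nonZero; prime⇒nonTrivial)
  open import Data.Nat.Combinatorics using (_C_; nCn≡1; k![n∸k]!∣n!)
  open import Data.Nat.Combinatorics.Specification using (nCk≡n!/k![n-k]!)
  open import Data.Fin.Base using (Fin; zero; suc; toℕ; inject₁; fromℕ)
  open import Data.Fin.Properties using (toℕ<n; toℕ-inject₁; toℕ-fromℕ)
  open import Data.Sum.Base using (inj₁; inj₂)
  open import Function.Base using (_∘_)
  open import Relation.Nullary using (¬_; contradiction)
  open import Relation.Binary.PropositionalEquality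
  import Algebra.Properties.CommutativeSemiring.Binomial as Binomial
  import Algebra.Properties.Monoid.Sum as MonoidSum
  import Algebra.Definitions.RawSemiring as RawSemiring
  open ModularArithmetic

  private
    module B = Binomial +-*-commutativeSemiring
    open MonoidSum +-0-monoid using (sum; sum-init-last)

  prime∤! : ∀ {p} → Prime p → ∀ {j} → j < p → ¬ p ∣ j !
  prime∤! pp {zero}  _   p∣1 = nonTrivial⇒≢1 {{prime⇒nonTrivial pp}} (∣1⇒≡1 p∣1)
  prime∤! pp {suc j} j<p p∣j! with euclidsLemma (suc j) (j !) pp p∣j!
  ... | inj₁ p∣j+1 = <⇒≱ j<p (∣⇒≤ p∣j+1)
  ... | inj₂ p∣j!′ = prime∤! pp (<-trans (n<1+n j) j<p) p∣j!′

  prime∣C : ∀ {p k} → Prime p → 0 < k → k < p → p ∣ p C k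
  prime∣C {p} {k} pp 0<k k<p with euclidsLemma (p C k) (k ! * (p ∸ k) !) pp p∣C*k![p∸k]!
    where
    instance _ = m*n≢0 (k !) ((p ∸ k) !) {{k !≢0}} {{(p ∸ k) !≢0}}
    p∣C*k![p∸k]! : p ∣ (p C k) * (k ! * (p ∸ k) !)
    p∣C*k![p∸k]! = subst (p ∣_)
      (trans (sym (m/n*n≡m (k![n∸k]!∣n! (<⇒≤ k<p)))) (cong (_* (k ! * (p ∸ k) !)) (sym (nCk≡n!/k![n-k]! (<⇒≤ k<p)))))
      (n∣n! p {{prime⇒nonZero pp}})
      where
      n∣n! : ∀ n .{{_ : NonZero n}} → n ∣ n !
      n∣n! (suc n) = m∣m*n (n !)
  ... | inj₁ p∣C = p∣C
  ... | inj₂ p∣k![p∸k]! with euclidsLemma (k !) ((p ∸ k) !) pp p∣k![p∸k]!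
  ...   | inj₁ p∣k! = contradiction p∣k! (prime∤! pp k<p)
  ...   | inj₂ p∣[p∸k]! = contradiction p∣[p∸k]! (prime∤! pp (∸-monoʳ-< 0<k (<⇒≤ k<p)))

  private
    -- the binomial theorem is stated with the semiring's own _×_ and _^_, which agree with
    -- ℕ's _*_ and _^_ only propositionally
    module S = RawSemiring +-*-rawSemiring

    ×≡* : ∀ n y → n S.× y ≡ n * y
    ×≡* zero    y = refl
    ×≡* (suc n) y = cong (y +_) (×≡* n y)

    ^≡^ : ∀ x n → x S.^ n ≡ x ^ n
    ^≡^ x zero    = refl
    ^≡^ x (suc n) = cong (x *_) (^≡^ x n)

    binomialTerm≡ : ∀ x n k → B.binomialTerm x 1 n k ≡ (n C toℕ k) * x ^ toℕ k
    binomialTerm≡ x n k = trans (×≡* (n C toℕ k) _) (cong ((n C toℕ k) *_)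
      (trans (cong₂ _*_ (^≡^ x (toℕ k)) (trans (^≡^ 1 (n ∸ toℕ k)) (^-zeroˡ (n ∸ toℕ k)))) (*-identityʳ _)))

    ∣-sum : ∀ {d n} (f : Fin n → ℕ) → (∀ i → d ∣ f i) → d ∣ sum f
    ∣-sum {d} {zero} f d∣f = d ∣0
    ∣-sum {n = suc n} f d∣f = ∣m∣n⇒∣m+n (d∣f zero) (∣-sum (f ∘ suc) (d∣f ∘ suc))

  freshman's-dream : ∀ {p} → Prime p → ∀ x → (x + 1) ^ p ≈ x ^ p + 1 [mod p ]
  freshman's-dream {p@(suc (suc n))} pp x = begin
    (x + 1) ^ p                                 ≡⟨ ^≡^ (x + 1) p ⟨
    (x + 1) S.^ p                               ≡⟨ B.theorem p x 1 ⟩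
    t zero + sum (t ∘ suc)                      ≡⟨ cong (t zero +_) (sum-init-last (t ∘ suc)) ⟩
    t zero + (sum (t ∘ suc ∘ inject₁) + t last) ≈⟨ +-congˡ (t zero) (+-congʳ (t last) (∣⇒≈0 (∣-sum _ inner-terms))) ⟩
    t zero + (0 + t last)                       ≡⟨ cong₂ _+_ t₀≡1 t-last≡x^p ⟩
    1 + x ^ p                                   ≡⟨ +-comm 1 (x ^ p) ⟩
    x ^ p + 1                                   ∎
    where
    open ≈-Reasoning p
    t : Fin (suc p) → ℕ
    t = B.binomialTerm x 1 p
    last : Fin (suc p)
    last = suc (fromℕ (suc n))
    t₀≡1 : t zero ≡ 1
    t₀≡1 = trans (binomialTerm≡ x p zero) (*-identityʳ 1)
    t-last≡x^p : t last ≡ x ^ p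
    t-last≡x^p = trans (binomialTerm≡ x p last)
      (trans (cong (λ k → (p C k) * x ^ k) (cong suc (cong suc (toℕ-fromℕ n)))) (trans (cong (_* x ^ p) (nCn≡1 p)) (*-identityˡ _)))
    inner-terms : ∀ i → p ∣ t (suc (inject₁ i))
    inner-terms i = subst (p ∣_) (sym (binomialTerm≡ x p (suc (inject₁ i))))
      (∣m⇒∣m*n _ (prime∣C pp (s≤s z≤n) (s≤s (subst (_< suc n) (sym (toℕ-inject₁ i)) (toℕ<n i)))))

  x^p≈x : ∀ {p} → Prime p → ∀ x → x ^ p ≈ x [mod p ]
  x^p≈x {p@(suc _)} pp zero    = ≈-refl
  x^p≈x {p}         pp (suc x) = begin
    suc x ^ p     ≡⟨ cong (_^ p) (+-comm 1 x) ⟩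
    (x + 1) ^ p   ≈⟨ freshman's-dream pp x ⟩
    x ^ p + 1     ≈⟨ +-congʳ 1 (x^p≈x pp x) ⟩
    x + 1         ≡⟨ +-comm x 1 ⟩
    suc x         ∎
    where open ≈-Reasoning p

  fermat : ∀ {p x} → Prime p → ¬ p ∣ x → x ^ (p ∸ 1) ≈ 1 [mod p ]
  fermat {p@(suc n)} {x} pp p∤x = *-cancelˡ-prime pp p∤x (begin
    x * x ^ n   ≈⟨ x^p≈x pp x ⟩
    x           ≡⟨ *-identityʳ x ⟨
    x * 1       ∎)
    where open ≈-Reasoning p

module FiniteDifferences where

  open import Data.Nat.Base as ℕ using (ℕ; zero; suc; _≤_; _<_; z≤n; s≤s; _!)
  import Data.Nat.Properties as ℕₚ
  open import Data.Nat.Divisibility using (_∣_; ∣⇒≤)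
  open import Data.Nat.Primality using (Prime)
  open import Data.Integer.Base using (ℤ; +_; 0ℤ; 1ℤ; -1ℤ; _+_; _-_; _*_; _^_)
  import Data.Integer.Properties as ℤₚ
  import Data.Integer.Divisibility.Signed as ℤ∣
  open import Data.Integer.Tactic.RingSolver using (solve-∀)
  open import Data.Fin.Base using (Fin; toℕ; fromℕ<)
  open import Data.Fin.Properties using (¬∀⟶∃¬; toℕ<n; toℕ-fromℕ<)
  open import Data.Product.Base using (Σ; _×_; _,_)
  open import Relation.Nullary using (¬_)
  open import Relation.Binary.PropositionalEquality
  open ModularArithmetic
  open Fermat using (prime∤!)

  private
    product-rule : ∀ n u v → (1ℤ + n) * v - n * u ≡ n * (v - u) + v
    product-rule = solve-∀

  Δ : (ℕ → ℤ) → ℕ → ℤ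
  Δ f n = f (suc n) - f n

  Δ^ : ℕ → (ℕ → ℤ) → ℕ → ℤ
  Δ^ zero    f = f
  Δ^ (suc d) f = Δ^ d (Δ f)

  -- f is a polynomial function of degree at most d with coefficient c at n ^ d,
  -- characterised through its differences
  data Polynomial : ℕ → ℤ → (ℕ → ℤ) → Set where
    constant   : ∀ {c f} → (∀ n → f n ≡ c) → Polynomial zero c f
    difference : ∀ {d c f} → Polynomial d (c * + suc d) (Δ f) → Polynomial (suc d) c f

  Δ^-polynomial : ∀ {d c f} → Polynomial d c f → ∀ n → Δ^ d f n ≡ c * + (d !)
  Δ^-polynomial {c = c} (constant f≡c) n = trans (f≡c n) (sym (ℤₚ.*-identityʳ c))
  Δ^-polynomial {suc d} {c} (difference P) n = trans (Δ^-polynomial P n)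
    (trans (ℤₚ.*-assoc c (+ suc d) (+ (d !))) (cong (c *_) (sym (ℤₚ.pos-* (suc d) (d !)))))

  ∣-Δ^ : ∀ {k} d f n → (∀ j → j ≤ d → k ℤ∣.∣ f (n ℕ.+ j)) → k ℤ∣.∣ Δ^ d f n
  ∣-Δ^ zero    f n k∣f = subst (_ ℤ∣.∣_) (cong f (ℕₚ.+-identityʳ n)) (k∣f 0 z≤n)
  ∣-Δ^ (suc d) f n k∣f = ∣-Δ^ d (Δ f) n λ j j≤d →
    ℤ∣.∣m∣n⇒∣m-n (subst (_ ℤ∣.∣_) (cong f (ℕₚ.+-suc n j)) (k∣f (suc j) (s≤s j≤d))) (k∣f j (ℕₚ.m≤n⇒m≤1+n j≤d))

  polynomial-coeff : ∀ {d c c′ f} → c ≡ c′ → Polynomial d c f → Polynomial d c′ f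
  polynomial-coeff refl P = P

  polynomial-ext : ∀ {d c f g} → (∀ n → f n ≡ g n) → Polynomial d c f → Polynomial d c g
  polynomial-ext f≗g (constant f≡c) = constant (λ n → trans (sym (f≗g n)) (f≡c n))
  polynomial-ext f≗g (difference P) = difference (polynomial-ext (λ n → cong₂ _-_ (f≗g (suc n)) (f≗g n)) P)

  polynomial-+ : ∀ {d c c′ f g} → Polynomial d c f → Polynomial d c′ g → Polynomial d (c + c′) (λ n → f n + g n)
  polynomial-+ (constant f≡c) (constant g≡c′) = constant (λ n → cong₂ _+_ (f≡c n) (g≡c′ n))
  polynomial-+ {suc d} {c} {c′} {f} {g} (difference P) (difference Q) =
    difference (polynomial-coeff (sym (ℤₚ.*-distribʳ-+ (+ suc d) c c′))
      (polynomial-ext (λ n → interchange (f (suc n)) (g (suc n)) (f n) (g n)) (polynomial-+ P Q)))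
    where
    interchange : ∀ a b c d → (a - c) + (b - d) ≡ (a + b) - (c + d)
    interchange = solve-∀

  polynomial-0 : ∀ d → Polynomial d 0ℤ (λ _ → 0ℤ)
  polynomial-0 zero    = constant (λ _ → refl)
  polynomial-0 (suc d) = difference (polynomial-0 d)

  polynomial-const : ∀ d c → Polynomial (suc d) 0ℤ (λ _ → c)
  polynomial-const d c = difference (polynomial-ext (λ _ → sym (ℤₚ.+-inverseʳ c)) (polynomial-0 d))

  polynomial-suc : ∀ {d c f} → Polynomial d c f → Polynomial d c (λ n → f (suc n))
  polynomial-suc (constant f≡c) = constant (λ n → f≡c (suc n))
  polynomial-suc (difference P) = difference (polynomial-suc P)

  polynomial-n* : ∀ {d c g} → Polynomial d c g → Polynomial (suc d) c (λ n → + n * g n)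
  polynomial-n* {c = c} {g} (constant g≡c) = difference (constant λ n → begin
    + suc n * g (suc n) - + n * g n     ≡⟨ product-rule (+ n) (g n) (g (suc n)) ⟩
    + n * (g (suc n) - g n) + g (suc n) ≡⟨ cong₂ (λ u v → + n * (u - v) + u) (g≡c (suc n)) (g≡c n) ⟩
    + n * (c - c) + c                   ≡⟨ vanish (+ n) c ⟩
    c * + 1                             ∎)
    where
    open ≡-Reasoning
    vanish : ∀ n c → n * (c - c) + c ≡ c * 1ℤ
    vanish = solve-∀
  polynomial-n* {suc d} {c} {g} P@(difference ΔP) = difference
    (polynomial-coeff (c*d+c≡c*[1+d] (+ suc d) c)
      (polynomial-ext (λ n → sym (product-rule (+ n) (g n) (g (suc n))))
        (polynomial-+ (polynomial-n* ΔP) (polynomial-suc P))))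
    where
    c*d+c≡c*[1+d] : ∀ d c → c * d + c ≡ c * (1ℤ + d)
    c*d+c≡c*[1+d] = solve-∀

  polynomial-^ : ∀ k → Polynomial k 1ℤ (λ n → (+ n) ^ k)
  polynomial-^ zero    = constant (λ _ → refl)
  polynomial-^ (suc k) = polynomial-n* (polynomial-^ k)

  private
    pos-^ : ∀ a k → + (a ℕ.^ k) ≡ (+ a) ^ k
    pos-^ a zero    = refl
    pos-^ a (suc k) = trans (ℤₚ.pos-* a (a ℕ.^ k)) (cong (+ a *_) (pos-^ a k))

  -- The k-th difference of (n + 1) ^ k - 1 is k!, and p ∤ k!, so
  -- x ^ k ≡ 1 cannot hold at all of the k + 1 points x = 1, …, k + 1.
  ∃-^≉1 : ∀ {p k} → Prime p → 1 ≤ k → suc k < p → Σ ℕ λ x → ¬ p ∣ x × ¬ x ℕ.^ k ≈ 1 [mod p ]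
  ∃-^≉1 {p} {k@(suc d)} pp _ k<p with ¬∀⟶∃¬ (suc k) (λ i → suc (toℕ i) ℕ.^ k ≈ 1 [mod p ]) (λ i → _ ≈? 1 [mod p ]) ¬all-roots
    where
    f : ℕ → ℤ
    f n = (+ suc n) ^ k - 1ℤ
    polynomial-f : Polynomial k (1ℤ + 0ℤ) f
    polynomial-f = polynomial-+ (polynomial-suc (polynomial-^ k)) (polynomial-const d -1ℤ)
    ¬all-roots : ¬ (∀ i → suc (toℕ i) ℕ.^ k ≈ 1 [mod p ])
    ¬all-roots all-roots = prime∤! pp (ℕₚ.<-trans (ℕₚ.n<1+n k) k<p) (ℤ∣.∣⇒∣ᵤ p∣k!)
      where
      root : ∀ j → j ≤ k → + p ℤ∣.∣ f j
      root j j≤k = subst (_ ℤ∣.∣_) (cong (_- 1ℤ) (pos-^ (suc j) k))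
        (modulus∣difference (subst (λ i → suc i ℕ.^ k ≈ 1 [mod p ]) (toℕ-fromℕ< (s≤s j≤k)) (all-roots (fromℕ< (s≤s j≤k)))))
      p∣k! : + p ℤ∣.∣ + (k !)
      p∣k! = subst (_ ℤ∣.∣_) (trans (Δ^-polynomial polynomial-f 0) (ℤₚ.*-identityˡ _)) (∣-Δ^ k f 0 root)
  ... | i , non-root = suc (toℕ i) , p∤x , non-root
    where
    p∤x : ¬ p ∣ suc (toℕ i)
    p∤x p∣x = ℕₚ.<⇒≱ (ℕₚ.≤-<-trans (toℕ<n i) k<p) (∣⇒≤ p∣x)

open import Data.Nat.Base
open import Data.Nat.Properties
open import Data.Nat.Divisibility
open import Data.Nat.DivMod using (_%_; m%n<n)
open import Data.Nat.GCD using (gcd; gcd-GCD; gcd[m,n]∣m; gcd[m,n]∣n; module Bézout)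
open import Data.Nat.Primality using (Prime; prime[2]; euclidsLemma; prime⇒nonZero; prime⇒nonTrivial)
open import Data.Nat.Coprimality as Coprimality using (Coprime; coprime-divisor; coprime-Bézout)
open import Data.Nat.Tactic.RingSolver using (solve-∀)
open import Data.Fin.Base using (Fin; toℕ; fromℕ<; punchOut)
open import Data.Fin.Properties using (toℕ-fromℕ<; toℕ-injective; punchOut-injective; injective⇒≤; pigeonhole; any?; toℕ<n) renaming (_≟_ to _≟ᶠ_)
open import Data.List.Base using (List; _∷_; length; lookup)
open import Data.List.Relation.Unary.All as All using (All; _∷_)
open import Data.List.Relation.Unary.Any as Any using (Any)
open import Data.List.Relation.Unary.Any.Properties using (lookup-index)
open import Data.List.Relation.Unary.AllPairs using (AllPairs; _∷_)
open import Data.List.Membership.Propositional.Properties using (∈-lookup)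
open import Data.Product.Base using (Σ; ∃; ∃-syntax; _×_; _,_; proj₁; proj₂)
open import Data.Sum.Base using (_⊎_; inj₁; inj₂; [_,_]′; map)
open import Function.Base using (_∘_; id)
open import Function.Definitions using (Injective)
open import Relation.Nullary using (¬_; Dec; yes; no; contradiction)
open import Relation.Binary.PropositionalEquality
open import Relation.Binary.Structures using (IsEquivalence)
open import Relation.Binary.Construct.Closure.ReflexiveTransitive using (ε; _◅_; _◅◅_)
open import Relation.Binary.Construct.Closure.Symmetric using (SymClosure; fwd; bwd)
open import Defs

open ModularArithmetic
open Fermat using (fermat)
open FiniteDifferences using (∃-^≉1)

-- Multiplicative orders

*-^ : ∀ y z k → (y * z) ^ k ≡ y ^ k * z ^ k
*-^ y z zero    = refl
*-^ y z (suc k) = trans (cong (y * z *_) (*-^ y z k)) (interchange y z (y ^ k) (z ^ k))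
  where
  interchange : ∀ a b c d → a * b * (c * d) ≡ a * c * (b * d)
  interchange = solve-∀

module _ {m : ℕ} where

  open ≈-Reasoning m

  ^*≈1 : ∀ x u t → x ^ u ≈ 1 [mod m ] → x ^ (u * t) ≈ 1 [mod m ]
  ^*≈1 x u t x^u≈1 = begin
    x ^ (u * t)   ≡⟨ ^-*-assoc x u t ⟨
    (x ^ u) ^ t   ≈⟨ ^-congˡ t x^u≈1 ⟩
    1 ^ t         ≡⟨ ^-zeroˡ t ⟩
    1             ∎

  ∣⇒^≈1 : ∀ x {u s} → u ∣ s → x ^ u ≈ 1 [mod m ] → x ^ s ≈ 1 [mod m ]
  ∣⇒^≈1 x {u} (divides t refl) x^u≈1 = subst (λ s → x ^ s ≈ 1 [mod m ]) (*-comm u t) (^*≈1 x u t x^u≈1)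

  private
    bézout-^≈1 : ∀ {x d u v} a b → d + b * v ≡ a * u → x ^ u ≈ 1 [mod m ] → x ^ v ≈ 1 [mod m ] → x ^ d ≈ 1 [mod m ]
    bézout-^≈1 {x} {d} {u} {v} a b eq x^u≈1 x^v≈1 = begin
      x ^ d                ≡⟨ *-identityʳ (x ^ d) ⟨
      x ^ d * 1            ≈⟨ *-congˡ (x ^ d) (^*≈1 x v b x^v≈1) ⟨
      x ^ d * x ^ (v * b)  ≡⟨ ^-distribˡ-+-* x d (v * b) ⟨
      x ^ (d + v * b)      ≡⟨ cong (λ k → x ^ (d + k)) (*-comm v b) ⟩
      x ^ (d + b * v)      ≡⟨ cong (x ^_) (trans eq (*-comm a u)) ⟩
      x ^ (u * a)          ≈⟨ ^*≈1 x u a x^u≈1 ⟩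
      1                    ∎

  ^-gcd≈1 : ∀ x u v → x ^ u ≈ 1 [mod m ] → x ^ v ≈ 1 [mod m ] → x ^ gcd u v ≈ 1 [mod m ]
  ^-gcd≈1 x u v x^u≈1 x^v≈1 with Bézout.identity (gcd-GCD u v)
  ... | Bézout.+- a b eq = bézout-^≈1 a b eq x^u≈1 x^v≈1
  ... | Bézout.-+ a b eq = bézout-^≈1 b a eq x^v≈1 x^u≈1

record HasOrder (m x d : ℕ) : Set where
  field
    ^order≈1 : x ^ d ≈ 1 [mod m ]
    order∣   : ∀ {s} → x ^ s ≈ 1 [mod m ] → d ∣ s
open HasOrder public

module _ {m : ℕ} where

  hasOrder-resp : ∀ {x y d} → x ≈ y [mod m ] → HasOrder m x d → HasOrder m y d
  hasOrder-resp {d = d} x≈y ord = record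
    { ^order≈1 = ≈-trans (^-congˡ d (≈-sym x≈y)) (^order≈1 ord)
    ; order∣   = λ {s} y^s≈1 → order∣ ord (≈-trans (^-congˡ s x≈y) y^s≈1)
    }

  -- The gcd d of s and ℓ ^ (e + 1) kills y; writing ℓ ^ (e + 1) = t · d,
  -- ℓ ∣ t would make d divide ℓ ^ e, so ℓ ∤ t and ℓ ^ (e + 1) ∣ d ∣ s.
  hasOrder-prime^ : ∀ {ℓ e y} → Prime ℓ → y ^ (ℓ ^ suc e) ≈ 1 [mod m ] → ¬ y ^ (ℓ ^ e) ≈ 1 [mod m ] →
                    HasOrder m y (ℓ ^ suc e)
  hasOrder-prime^ {ℓ} {e} {y} pℓ y^ℓ^[1+e]≈1 y^ℓ^e≉1 = record { ^order≈1 = y^ℓ^[1+e]≈1 ; order∣ = order∣′ }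
    where
    instance _ = prime⇒nonZero pℓ
    order∣′ : ∀ {s} → y ^ s ≈ 1 [mod m ] → ℓ ^ suc e ∣ s
    order∣′ {s} y^s≈1 with gcd[m,n]∣n s (ℓ ^ suc e)
    ... | divides t ℓ^[1+e]≡t*d = ∣-trans (coprime-divisor ℓ^[1+e]⊥t ℓ^[1+e]∣t*d) (gcd[m,n]∣m s (ℓ ^ suc e))
      where
      d : ℕ
      d = gcd s (ℓ ^ suc e)
      ℓ∤t : ¬ ℓ ∣ t
      ℓ∤t (divides t′ t≡t′*ℓ) = y^ℓ^e≉1 (∣⇒^≈1 y (divides t′ ℓ^e≡t′*d) (^-gcd≈1 y s (ℓ ^ suc e) y^s≈1 y^ℓ^[1+e]≈1))
        where
        ℓ^e≡t′*d : ℓ ^ e ≡ t′ * d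
        ℓ^e≡t′*d = *-cancelˡ-≡ (ℓ ^ e) (t′ * d) ℓ (trans ℓ^[1+e]≡t*d (trans (cong (_* d) t≡t′*ℓ) (regroup t′ ℓ d)))
          where
          regroup : ∀ a b c → a * b * c ≡ b * (a * c)
          regroup = solve-∀
      ℓ^[1+e]⊥t : Coprime (ℓ ^ suc e) t
      ℓ^[1+e]⊥t = coprime-^ˡ (prime∤⇒coprime pℓ ℓ∤t) (suc e)
      ℓ^[1+e]∣t*d : ℓ ^ suc e ∣ t * d
      ℓ^[1+e]∣t*d = subst (ℓ ^ suc e ∣_) ℓ^[1+e]≡t*d ∣-refl

  private
    order∣-factor : ∀ {y z a b s} → Coprime a b → HasOrder m y a → HasOrder m z b →
                    (y * z) ^ s ≈ 1 [mod m ] → a ∣ s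
    order∣-factor {y} {z} {a} {b} {s} a⊥b ord-y ord-z [yz]^s≈1 =
      coprime-divisor a⊥b (subst (a ∣_) (*-comm s b) (order∣ ord-y y^sb≈1))
      where
      open ≈-Reasoning m
      y^sb≈1 : y ^ (s * b) ≈ 1 [mod m ]
      y^sb≈1 = begin
        y ^ (s * b)                ≡⟨ *-identityʳ _ ⟨
        y ^ (s * b) * 1            ≈⟨ *-congˡ (y ^ (s * b)) (∣⇒^≈1 z (∣n⇒∣m*n s (∣-refl {b})) (^order≈1 ord-z)) ⟨
        y ^ (s * b) * z ^ (s * b)  ≡⟨ *-^ y z (s * b) ⟨
        (y * z) ^ (s * b)          ≈⟨ ^*≈1 (y * z) s b [yz]^s≈1 ⟩
        1                          ∎

  hasOrder-* : ∀ {y z a b} → Coprime a b → HasOrder m y a → HasOrder m z b → HasOrder m (y * z) (a * b)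
  hasOrder-* {y} {z} {a} {b} a⊥b ord-y ord-z = record
    { ^order≈1 = begin
        (y * z) ^ (a * b)           ≡⟨ *-^ y z (a * b) ⟩
        y ^ (a * b) * z ^ (a * b)   ≈⟨ *-cong (^*≈1 y a b (^order≈1 ord-y)) (∣⇒^≈1 z (∣n⇒∣m*n a (∣-refl {b})) (^order≈1 ord-z)) ⟩
        1                           ∎
    ; order∣ = λ {s} [yz]^s≈1 → coprime⇒*∣ a⊥b
        (order∣-factor a⊥b ord-y ord-z [yz]^s≈1)
        (order∣-factor (Coprimality.sym a⊥b) ord-z ord-y (subst (λ w → w ^ s ≈ 1 [mod m ]) (*-comm y z) [yz]^s≈1))
    }
    where open ≈-Reasoning m

  private
    ^-+-period : ∀ {g d} → HasOrder m g d → ∀ j k → g ^ (j + k * d) ≈ g ^ j [mod m ]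
    ^-+-period {g} {d} ord j k = begin
      g ^ (j + k * d)        ≡⟨ ^-distribˡ-+-* g j (k * d) ⟩
      g ^ j * g ^ (k * d)    ≈⟨ *-congˡ (g ^ j) (∣⇒^≈1 g (∣n⇒∣m*n k (∣-refl {d})) (^order≈1 ord)) ⟩
      g ^ j * 1              ≡⟨ *-identityʳ (g ^ j) ⟩
      g ^ j                  ∎
      where open ≈-Reasoning m

  ^-cong-exponent : ∀ {g d i j} → HasOrder m g d → i ≈ j [mod d ] → g ^ i ≈ g ^ j [mod m ]
  ^-cong-exponent {i = i} {j} ord i≈j with ≈⇒≡mod i≈j
  ... | inj₁ (k , refl) = ^-+-period ord j k
  ... | inj₂ (k , refl) = ≈-sym (^-+-period ord i k)

  hasOrder-^ : ∀ {g d c} → HasOrder m g d → Coprime d c → HasOrder m (g ^ c) d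
  hasOrder-^ {g} {d} {c} ord d⊥c = record
    { ^order≈1 = begin
        (g ^ c) ^ d   ≡⟨ ^-*-assoc g c d ⟩
        g ^ (c * d)   ≈⟨ ∣⇒^≈1 g (∣n⇒∣m*n c (∣-refl {d})) (^order≈1 ord) ⟩
        1             ∎
    ; order∣ = λ {s} [g^c]^s≈1 → coprime-divisor d⊥c (order∣ ord (≈-trans (≈-reflexive (sym (^-*-assoc g c s))) [g^c]^s≈1))
    }
    where open ≈-Reasoning m

-- Primitive roots

injective⇒surjective : ∀ {n} {f : Fin n → Fin n} → Injective _≡_ _≡_ f → ∀ y → ∃ λ x → f x ≡ y
injective⇒surjective {suc n} {f} f-inj y with any? (λ x → f x ≟ᶠ y)
... | yes hit = hit
... | no miss = contradiction (injective⇒≤ g-inj) (<-irrefl refl)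
  where
  g : Fin (suc n) → Fin n
  g x = punchOut {i = y} {j = f x} (λ y≡fx → miss (x , sym y≡fx))
  g-inj : Injective _≡_ _≡_ g
  g-inj eq = f-inj (punchOut-injective {i = y} _ _ eq)

module _ {p : ℕ} (pp : Prime p) where

  private instance _ = prime⇒nonZero pp

  unit-* : ∀ {x y} → ¬ p ∣ x → ¬ p ∣ y → ¬ p ∣ x * y
  unit-* {x} {y} p∤x p∤y p∣xy = [ p∤x , p∤y ]′ (euclidsLemma x y pp p∣xy)

  unit-^ : ∀ {x} k → ¬ p ∣ x → ¬ p ∣ x ^ k
  unit-^ zero    _   p∣1 = nonTrivial⇒≢1 {{prime⇒nonTrivial pp}} (∣1⇒≡1 p∣1)
  unit-^ (suc k) p∤x = unit-* p∤x (unit-^ k p∤x)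

  InUnits⇒unit : ∀ {x} → InUnits p x → ¬ p ∣ x
  InUnits⇒unit {suc x} (_ , x<p) p∣x = <⇒≱ x<p (∣⇒≤ p∣x)

  1≤%-unit : ∀ {x} → ¬ p ∣ x → 1 ≤ x % p
  1≤%-unit {x} p∤x = n≢0⇒n>0 (λ x%p≡0 → p∤x (m%n≡0⇒n∣m x p x%p≡0))

  %-InUnits : ∀ {x} → ¬ p ∣ x → InUnits p (x % p)
  %-InUnits {x} p∤x = 1≤%-unit p∤x , m%n<n x p

  private
    exponent-gap : ∀ {g d i j} → ¬ p ∣ g → HasOrder p g d → i ≤ j → g ^ i ≈ g ^ j [mod p ] → j ≈ i [mod d ]
    exponent-gap {g} {d} {i} {j} p∤g ord i≤j g^i≈g^j with order∣ ord g^[j∸i]≈1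
      where
      open ≈-Reasoning p
      g^[j∸i]≈1 : g ^ (j ∸ i) ≈ 1 [mod p ]
      g^[j∸i]≈1 = ≈-sym (*-cancelˡ-prime pp (unit-^ i p∤g) (begin
        g ^ i * 1            ≡⟨ *-identityʳ (g ^ i) ⟩
        g ^ i                ≈⟨ g^i≈g^j ⟩
        g ^ j                ≡⟨ cong (g ^_) (m+[n∸m]≡n i≤j) ⟨
        g ^ (i + (j ∸ i))    ≡⟨ ^-distribˡ-+-* g i (j ∸ i) ⟩
        g ^ i * g ^ (j ∸ i)  ∎))
    ... | divides k j∸i≡k*d =
      subst (λ j → j ≈ i [mod d ]) (trans (cong (i +_) (sym j∸i≡k*d)) (m+[n∸m]≡n i≤j)) (+-multiple i k)

  ^-injective : ∀ {g d i j} → ¬ p ∣ g → HasOrder p g d → g ^ i ≈ g ^ j [mod p ] → i ≈ j [mod d ]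
  ^-injective {i = i} {j} p∤g ord g^i≈g^j with ≤-total i j
  ... | inj₁ i≤j = ≈-sym (exponent-gap p∤g ord i≤j g^i≈g^j)
  ... | inj₂ j≤i = exponent-gap p∤g ord j≤i (≈-sym g^i≈g^j)

  private
    index : ∀ {x} → ¬ p ∣ x → Fin (p ∸ 1)
    index {x} p∤x = fromℕ< (∸-monoˡ-< (m%n<n x p) (1≤%-unit p∤x))

    index-≡⇒≈ : ∀ {x y} (p∤x : ¬ p ∣ x) (p∤y : ¬ p ∣ y) → index p∤x ≡ index p∤y → x ≈ y [mod p ]
    index-≡⇒≈ {x} {y} p∤x p∤y eq = ≈-trans (≈-sym (m%n≈m x p)) (≈-trans (≈-reflexive x%p≡y%p) (m%n≈m y p))
      where
      x%p≡y%p : x % p ≡ y % p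
      x%p≡y%p = ∸-cancelʳ-≡ (1≤%-unit p∤x) (1≤%-unit p∤y)
        (trans (sym (toℕ-fromℕ< _)) (trans (cong toℕ eq) (toℕ-fromℕ< _)))

  -- k ↦ g ^ k is injective on exponents below p - 1, hence onto the p - 1 units.
  powers-exhaust : ∀ {g x} → ¬ p ∣ g → HasOrder p g (p ∸ 1) → ¬ p ∣ x → ∃ λ (k : Fin (p ∸ 1)) → g ^ toℕ k ≈ x [mod p ]
  powers-exhaust {g} {x} p∤g ord p∤x =
    let k , fk≡x = injective⇒surjective f-injective (index p∤x) in k , index-≡⇒≈ (p∤g^ k) p∤x fk≡x
    where
    p∤g^ : ∀ k → ¬ p ∣ g ^ toℕ k
    p∤g^ k = unit-^ (toℕ k) p∤g
    f : Fin (p ∸ 1) → Fin (p ∸ 1)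
    f k = index (p∤g^ k)
    f-injective : Injective _≡_ _≡_ f
    f-injective {i} {j} eq = toℕ-injective (≈∧<⇒≡ (toℕ<n i) (toℕ<n j) (^-injective p∤g ord (index-≡⇒≈ (p∤g^ i) (p∤g^ j) eq)))

  hasOrder⇒isGen : ∀ {g} → InUnits p g → HasOrder p g (p ∸ 1) → IsGen p g
  hasOrder⇒isGen g-unit ord = g-unit , λ x x-unit →
    let k , g^k≈x = powers-exhaust (InUnits⇒unit g-unit) ord (InUnits⇒unit x-unit) in toℕ k , ≈⇒≡mod g^k≈x

  1≤p∸1 : 1 ≤ p ∸ 1
  1≤p∸1 = ∸-monoˡ-≤ 1 (nonTrivial⇒n>1 p {{prime⇒nonTrivial pp}})

  private
    N<p : p ∸ 1 < p
    N<p = ∸-monoʳ-< {p} {1} {0} z<s (≤-trans (s≤s z≤n) (nonTrivial⇒n>1 p {{prime⇒nonTrivial pp}}))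

  -- With p - 1 = ℓ · k, some unit x has x ^ k ≉ 1, and then x ^ M has order ℓ ^ (e + 1).
  ∃-order-prime^ : ∀ {ℓ e M} → Prime ℓ → p ∸ 1 ≡ ℓ ^ suc e * M → Σ ℕ λ y → ¬ p ∣ y × HasOrder p y (ℓ ^ suc e)
  ∃-order-prime^ {ℓ} {e} {M} pℓ N≡ℓ^[1+e]*M =
    let x , p∤x , x^k≉1 = ∃-^≉1 pp 1≤k (≤-<-trans k<N N<p)
    in x ^ M , unit-^ M p∤x , hasOrder-prime^ {e = e} pℓ (x^M^ℓ^[1+e]≈1 p∤x) (x^k≉1 ∘ x^M^ℓ^e≈x^k)
    where
    k : ℕ
    k = ℓ ^ e * M
    N≡ℓ*k : p ∸ 1 ≡ ℓ * k
    N≡ℓ*k = trans N≡ℓ^[1+e]*M (*-assoc ℓ (ℓ ^ e) M)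
    1≤k : 1 ≤ k
    1≤k = n≢0⇒n>0 λ k≡0 → <⇒≢ 1≤p∸1 (sym (trans N≡ℓ*k (trans (cong (ℓ *_) k≡0) (*-zeroʳ ℓ))))
    k<N : k < p ∸ 1
    k<N = subst (k <_) (trans (*-comm k ℓ) (sym N≡ℓ*k)) (m<m*n k ℓ {{>-nonZero 1≤k}} (nonTrivial⇒n>1 ℓ {{prime⇒nonTrivial pℓ}}))
    x^M^ℓ^[1+e]≈1 : ∀ {x} → ¬ p ∣ x → (x ^ M) ^ (ℓ ^ suc e) ≈ 1 [mod p ]
    x^M^ℓ^[1+e]≈1 {x} p∤x = begin
      (x ^ M) ^ (ℓ ^ suc e)  ≡⟨ ^-*-assoc x M (ℓ ^ suc e) ⟩
      x ^ (M * ℓ ^ suc e)    ≡⟨ cong (x ^_) (trans (*-comm M (ℓ ^ suc e)) (sym N≡ℓ^[1+e]*M)) ⟩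
      x ^ (p ∸ 1)            ≈⟨ fermat pp p∤x ⟩
      1                      ∎
      where open ≈-Reasoning p
    x^M^ℓ^e≈x^k : ∀ {x} → (x ^ M) ^ (ℓ ^ e) ≈ 1 [mod p ] → x ^ k ≈ 1 [mod p ]
    x^M^ℓ^e≈x^k {x} = ≈-trans (≈-reflexive (trans (cong (x ^_) (*-comm (ℓ ^ e) M)) (sym (^-*-assoc x M (ℓ ^ e)))))

  private
    regroup₁ : ∀ a b c → a * b * c ≡ a * (b * c)
    regroup₁ = solve-∀
    regroup₂ : ∀ a b c → a * b * c ≡ b * (a * c)
    regroup₂ = solve-∀
    regroup₃ : ∀ a b c → a * b * c ≡ c * (a * b)
    regroup₃ = solve-∀

  ∃-primitiveRoot : ∀ {ℓ₁ ℓ₂ ℓ₃ e₁ e₂ e₃} → Prime ℓ₁ → Prime ℓ₂ → Prime ℓ₃ → ℓ₁ ≢ ℓ₂ → ℓ₁ ≢ ℓ₃ → ℓ₂ ≢ ℓ₃ →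
                    p ∸ 1 ≡ ℓ₁ ^ suc e₁ * ℓ₂ ^ suc e₂ * ℓ₃ ^ suc e₃ →
                    Σ ℕ λ ω → ¬ p ∣ ω × HasOrder p ω (p ∸ 1)
  ∃-primitiveRoot {ℓ₁} {ℓ₂} {ℓ₃} {e₁} {e₂} {e₃} p₁ p₂ p₃ ℓ₁≢ℓ₂ ℓ₁≢ℓ₃ ℓ₂≢ℓ₃ N≡A*B*C =
    let y₁ , p∤y₁ , ord₁ = ∃-order-prime^ {e = e₁} p₁ (trans N≡A*B*C (regroup₁ A B C))
        y₂ , p∤y₂ , ord₂ = ∃-order-prime^ {e = e₂} p₂ (trans N≡A*B*C (regroup₂ A B C))
        y₃ , p∤y₃ , ord₃ = ∃-order-prime^ {e = e₃} p₃ (trans N≡A*B*C (regroup₃ A B C))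
    in y₁ * y₂ * y₃ , unit-* (unit-* p∤y₁ p∤y₂) p∤y₃ ,
       subst (HasOrder p (y₁ * y₂ * y₃)) (sym N≡A*B*C) (hasOrder-* A*B⊥C (hasOrder-* A⊥B ord₁ ord₂) ord₃)
    where
    A B C : ℕ
    A = ℓ₁ ^ suc e₁
    B = ℓ₂ ^ suc e₂
    C = ℓ₃ ^ suc e₃
    A⊥B : Coprime A B
    A⊥B = coprime-^ (primes-coprime p₁ p₂ ℓ₁≢ℓ₂) (suc e₁) (suc e₂)
    A*B⊥C : Coprime (A * B) C
    A*B⊥C = coprime-*ˡ (coprime-^ (primes-coprime p₁ p₃ ℓ₁≢ℓ₃) (suc e₁) (suc e₃))
                       (coprime-^ (primes-coprime p₂ p₃ ℓ₂≢ℓ₃) (suc e₂) (suc e₃))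

module DiscreteLog {p ω : ℕ} (pp : Prime p) (p∤ω : ¬ p ∣ ω) (ω-order : HasOrder p ω (p ∸ 1)) where

  private instance _ = prime⇒nonZero pp

  exp : ℕ → ℕ
  exp u = ω ^ u % p

  exp≈ : ∀ u → exp u ≈ ω ^ u [mod p ]
  exp≈ u = m%n≈m (ω ^ u) p

  exp-InUnits : ∀ u → InUnits p (exp u)
  exp-InUnits u = %-InUnits pp (unit-^ pp u p∤ω)

  ω^-cong : ∀ {u v} → u ≈ v [mod p ∸ 1 ] → ω ^ u ≈ ω ^ v [mod p ]
  ω^-cong = ^-cong-exponent ω-order

  ω^-injective : ∀ {u v} → ω ^ u ≈ ω ^ v [mod p ] → u ≈ v [mod p ∸ 1 ]
  ω^-injective = ^-injective pp p∤ω ω-order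

  -- the least k < p - 1 with ω ^ k ≈ x, and 0 when x is not a unit
  log : ℕ → ℕ
  log x with any? (λ (k : Fin (p ∸ 1)) → ω ^ toℕ k ≈? x [mod p ])
  ... | yes (k , _) = toℕ k
  ... | no _        = 0

  ω^log : ∀ {x} → ¬ p ∣ x → ω ^ log x ≈ x [mod p ]
  ω^log {x} p∤x with any? (λ (k : Fin (p ∸ 1)) → ω ^ toℕ k ≈? x [mod p ])
  ... | yes (_ , ω^k≈x) = ω^k≈x
  ... | no none         = contradiction (powers-exhaust pp p∤ω ω-order p∤x) none

  log-unique : ∀ {x u} → ¬ p ∣ x → x ≈ ω ^ u [mod p ] → log x ≈ u [mod p ∸ 1 ]
  log-unique p∤x x≈ω^u = ω^-injective (≈-trans (ω^log p∤x) x≈ω^u)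

  log-exp : ∀ u → log (exp u) ≈ u [mod p ∸ 1 ]
  log-exp u = log-unique (InUnits⇒unit pp (exp-InUnits u)) (exp≈ u)

  isGen⇒coprime : ∀ {h c} → IsGen p h → h ≈ ω ^ c [mod p ] → Coprime (p ∸ 1) c
  isGen⇒coprime {h} {c} (_ , powers-of-h) h≈ω^c with powers-of-h (exp 1) (exp-InUnits 1)
  ... | t , h^t≡exp1 = *≈1⇒coprime (ω^-injective (begin
    ω ^ (c * t)   ≡⟨ ^-*-assoc ω c t ⟨
    (ω ^ c) ^ t   ≈⟨ ^-congˡ t h≈ω^c ⟨
    h ^ t         ≈⟨ ≡mod⇒≈ h^t≡exp1 ⟩
    exp 1         ≈⟨ exp≈ 1 ⟩
    ω ^ 1         ∎))
    where open ≈-Reasoning p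

  coprime⇒isGen : ∀ {h c} → InUnits p h → h ≈ ω ^ c [mod p ] → Coprime (p ∸ 1) c → IsGen p h
  coprime⇒isGen h-unit h≈ω^c N⊥c = hasOrder⇒isGen pp h-unit (hasOrder-resp (≈-sym h≈ω^c) (hasOrder-^ ω-order N⊥c))

  isGen⇒coprime-log : ∀ {h} → IsGen p h → Coprime (p ∸ 1) (log h)
  isGen⇒coprime-log G@(h-unit , _) = isGen⇒coprime G (≈-sym (ω^log (InUnits⇒unit pp h-unit)))

  isGen-exp : ∀ {c} → Coprime (p ∸ 1) c → IsGen p (exp c)
  isGen-exp {c} = coprime⇒isGen (exp-InUnits c) (exp≈ c)

module Orbit {A : Set} {_∼_ : A → A → Set} (∼-isEquivalence : IsEquivalence _∼_) (o : ℕ → A)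
  (o-suc-cong : ∀ {i j} → o i ∼ o j → o (suc i) ∼ o (suc j))
  (o-suc-injective : ∀ {i j} → o (suc i) ∼ o (suc j) → o i ∼ o j) where

  open import Data.Fin.Base using (zero; suc)

  open IsEquivalence ∼-isEquivalence renaming (refl to ∼-refl; sym to ∼-sym; trans to ∼-trans)

  o-+-injective : ∀ k {i j} → o (k + i) ∼ o (k + j) → o i ∼ o j
  o-+-injective zero    = id
  o-+-injective (suc k) = o-+-injective k ∘ o-suc-injective

  o-mod : ∀ {d} → 0 < d → o 0 ∼ o d → ∀ k → ∃ λ r → r < d × o k ∼ o r
  o-mod 0<d o₀∼o_d zero    = 0 , 0<d , ∼-refl
  o-mod 0<d o₀∼o_d (suc k) with o-mod 0<d o₀∼o_d k
  ... | r , r<d , oₖ∼oᵣ with m≤n⇒m<n∨m≡n r<d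
  ...   | inj₁ 1+r<d = suc r , 1+r<d , o-suc-cong oₖ∼oᵣ
  ...   | inj₂ refl  = 0 , 0<d , ∼-trans (o-suc-cong oₖ∼oᵣ) (∼-sym o₀∼o_d)

  lookup-injective : ∀ {xs} → AllPairs (λ a b → ¬ a ∼ b) xs → ∀ {i j} → lookup xs i ∼ lookup xs j → i ≡ j
  lookup-injective (_ ∷ _)    {zero}  {zero}  _  = refl
  lookup-injective (px ∷ _)   {zero}  {suc j} eq = contradiction eq (All.lookup px (∈-lookup j))
  lookup-injective (px ∷ _)   {suc i} {zero}  eq = contradiction (∼-sym eq) (All.lookup px (∈-lookup i))
  lookup-injective (_ ∷ pxs)  {suc i} {suc j} eq = cong suc (lookup-injective pxs eq)

  -- Pigeonhole twice: two of o 0, …, o (length hs) meet the same entry, giving a return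
  -- o 0 ∼ o d with 0 < d ≤ length hs; reducing exponents modulo d maps hs injectively below d.
  orbit-length : (hs : List A) → AllPairs (λ a b → ¬ a ∼ b) hs →
                 (∀ k → Any (o k ∼_) hs) → All (λ h → ∃ λ k → h ∼ o k) hs → o 0 ∼ o (length hs)
  orbit-length hs distinct covers within with period
    where
    slot : ℕ → Fin (length hs)
    slot k = Any.index (covers k)
    period : ∃ λ d → 0 < d × d ≤ length hs × o 0 ∼ o d
    period with i , j , i<j , slotᵢ≡slotⱼ ← pigeonhole (n<1+n (length hs)) (slot ∘ toℕ) =
      toℕ j ∸ toℕ i , m<n⇒0<n∸m i<j , ≤-trans (m∸n≤m (toℕ j) (toℕ i)) (≤-pred (toℕ<n j)) ,
      o-+-injective (toℕ i) (subst₂ (λ a b → o a ∼ o b) (sym (+-identityʳ (toℕ i))) (sym (m+[n∸m]≡n (<⇒≤ i<j))) oᵢ∼oⱼ)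
      where
      oᵢ∼oⱼ : o (toℕ i) ∼ o (toℕ j)
      oᵢ∼oⱼ = ∼-trans (lookup-index (covers (toℕ i)))
                (subst (λ s → lookup hs s ∼ o (toℕ j)) (sym slotᵢ≡slotⱼ) (∼-sym (lookup-index (covers (toℕ j)))))
  ... | d , 0<d , d≤L , o₀∼o_d = subst (λ n → o 0 ∼ o n) (≤-antisym d≤L L≤d) o₀∼o_d
    where
    residue : ∀ t → ∃ λ r → r < d × lookup hs t ∼ o r
    residue t with All.lookup within (∈-lookup t)
    ... | k , hₜ∼oₖ with o-mod 0<d o₀∼o_d k
    ...   | r , r<d , oₖ∼oᵣ = r , r<d , ∼-trans hₜ∼oₖ oₖ∼oᵣ
    residue-fin : Fin (length hs) → Fin d
    residue-fin t = fromℕ< (proj₁ (proj₂ (residue t)))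
    residue-injective : ∀ {t u} → residue-fin t ≡ residue-fin u → t ≡ u
    residue-injective {t} {u} eq = lookup-injective distinct
      (∼-trans (proj₂ (proj₂ (residue t))) (subst (λ s → o s ∼ lookup hs u) (sym r≡r′) (∼-sym (proj₂ (proj₂ (residue u))))))
      where
      r≡r′ : proj₁ (residue t) ≡ proj₁ (residue u)
      r≡r′ = trans (sym (toℕ-fromℕ< _)) (trans (cong toℕ eq) (toℕ-fromℕ< _))
    L≤d : length hs ≤ d
    L≤d = injective⇒≤ residue-injective

module MissingGenerators {p q₁ q₂ i j₁ j₂ x : ℕ} (pp : Prime p) (pq₁ : Prime q₁) (pq₂ : Prime q₂)
  (q₁≢q₂ : q₁ ≢ q₂) (q₁≢2 : q₁ ≢ 2) (q₂≢2 : q₂ ≢ 2)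
  (N≡ : p ∸ 1 ≡ 2 ^ suc i * q₁ ^ suc j₁ * q₂ ^ suc j₂)
  (2∤x : ¬ 2 ∣ x) (x≈2 : x ≈ 2 [mod q₁ ]) (x+2≈0 : x + 2 ≈ 0 [mod q₂ ]) where

  private
    N m : ℕ
    N = p ∸ 1
    m = q₁ * q₂

    root : Σ ℕ λ ω → ¬ p ∣ ω × HasOrder p ω (p ∸ 1)
    root = ∃-primitiveRoot pp {e₁ = i} {e₂ = j₁} {e₃ = j₂} prime[2] pq₁ pq₂ (q₁≢2 ∘ sym) (q₂≢2 ∘ sym) q₁≢q₂ N≡

    ω : ℕ
    ω = proj₁ root

  open DiscreteLog pp (proj₁ (proj₂ root)) (proj₂ (proj₂ root))

  2∣N : 2 ∣ N
  2∣N = subst (2 ∣_) (sym N≡) (∣m⇒∣m*n _ (∣m⇒∣m*n _ (m∣m*n (2 ^ i))))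

  q₁∣N : q₁ ∣ N
  q₁∣N = subst (q₁ ∣_) (sym N≡) (∣m⇒∣m*n _ (∣n⇒∣m*n (2 ^ suc i) (m∣m*n (q₁ ^ j₁))))

  q₂∣N : q₂ ∣ N
  q₂∣N = subst (q₂ ∣_) (sym N≡) (∣n⇒∣m*n (2 ^ suc i * q₁ ^ suc j₁) (m∣m*n (q₂ ^ j₂)))

  m∣N : m ∣ N
  m∣N = coprime⇒*∣ (primes-coprime pq₁ pq₂ q₁≢q₂) q₁∣N q₂∣N

  coprime⇒∤ : ∀ {ℓ c} → Prime ℓ → ℓ ∣ N → Coprime N c → ¬ ℓ ∣ c
  coprime⇒∤ pℓ ℓ∣N N⊥c ℓ∣c = nonTrivial⇒≢1 {{prime⇒nonTrivial pℓ}} (N⊥c (ℓ∣N , ℓ∣c))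

  ∤⇒coprime : ∀ {c} → ¬ 2 ∣ c → ¬ q₁ ∣ c → ¬ q₂ ∣ c → Coprime N c
  ∤⇒coprime {c} 2∤c q₁∤c q₂∤c = subst (λ n → Coprime n c) (sym N≡)
    (coprime-*ˡ (coprime-*ˡ (power prime[2] 2∤c (suc i)) (power pq₁ q₁∤c (suc j₁))) (power pq₂ q₂∤c (suc j₂)))
    where
    power : ∀ {ℓ} → Prime ℓ → ¬ ℓ ∣ c → ∀ e → Coprime (ℓ ^ e) c
    power pℓ ℓ∤c = coprime-^ˡ (prime∤⇒coprime pℓ ℓ∤c)

  -- ω ^ inv a is the inverse of ω ^ a
  inv : ℕ → ℕ
  inv a = a * (N ∸ 1)

  +-inv≈0 : ∀ a → a + inv a ≈ 0 [mod N ]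
  +-inv≈0 a = ≈-trans (≈-reflexive (trans (sym (*-suc a (N ∸ 1))) (cong (a *_) 1+[N∸1]≡N))) (∣⇒≈0 (n∣m*n a))
    where
    1+[N∸1]≡N : suc (N ∸ 1) ≡ N
    1+[N∸1]≡N = trans (+-comm 1 (N ∸ 1)) (m∸n+n≡m (1≤p∸1 pp))

  odd-inv : ∀ {a} → ¬ 2 ∣ a → ¬ 2 ∣ inv a
  odd-inv {a} 2∤a = ≈1⇒odd (*-cong (odd⇒≈1 2∤a) N∸1≈1)
    where
    N∸1≈1 : N ∸ 1 ≈ 1 [mod 2 ]
    N∸1≈1 = +-cancelʳ 1 (≈-trans (≈-reflexive (m∸n+n≡m (1≤p∸1 pp))) (≈-trans (∣⇒≈0 2∣N) (≈-sym (∣⇒≈0 (∣-refl {2})))))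

  -- Shift a ā c: some r = ω ^ (2b) lies in ℐ(g) for g = ω ^ a, g⁻¹ = ω ^ ā, with ω ^ c = g r.
  Shift : ℕ → ℕ → ℕ → Set
  Shift a ā c = ∃ λ b → Coprime N (a + (b + b)) × Coprime N (ā + (b + b)) × c ≈ a + (b + b) [mod N ]

  module _ (a ā : ℕ) (a+ā≈0 : a + ā ≈ 0 [mod N ]) where

    shift⇒≉ : ∀ {q c} → Prime q → q ∣ N → Shift a ā c → ¬ c ≈ a + a [mod q ]
    shift⇒≉ {q} {c} pq q∣N (b , _ , N⊥ā+2b , c≈a+2b) c≈a+a =
      coprime⇒∤ pq q∣N N⊥ā+2b (≈0⇒∣ (+-cancelʳ (a + a) (begin
        ā + (b + b) + (a + a)   ≡⟨ regroup a ā (b + b) ⟩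
        (a + ā) + (a + (b + b)) ≈⟨ +-cong (≈-divisor q∣N a+ā≈0) (≈-sym (≈-divisor q∣N c≈a+2b)) ⟩
        0 + c                   ≈⟨ c≈a+a ⟩
        0 + (a + a)             ∎)))
      where
      open ≈-Reasoning q
      regroup : ∀ a ā d → ā + d + (a + a) ≡ (a + ā) + (a + d)
      regroup = solve-∀

    private
      half : ∀ {n} → 2 ∣ n → ∃ λ b → b + b ≡ n
      half (divides b refl) = b , double b
        where
        double : ∀ b → b + b ≡ b * 2
        double = solve-∀

    -- the witness is 2b = c + ā
    shift⇐ : ∀ {c} → Coprime N c → ¬ 2 ∣ ā → ¬ c ≈ a + a [mod q₁ ] → ¬ c ≈ a + a [mod q₂ ] → Shift a ā c
    shift⇐ {c} N⊥c 2∤ā c≉2a₁ c≉2a₂ = shift-witness (half 2∣c+ā)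
      where
      2∤c : ¬ 2 ∣ c
      2∤c = coprime⇒∤ prime[2] 2∣N N⊥c
      2∣c+ā : 2 ∣ c + ā
      2∣c+ā = ≈0⇒∣ (≈-trans (+-cong (odd⇒≈1 2∤c) (odd⇒≈1 2∤ā)) (∣⇒≈0 (∣-refl {2})))
      shift-witness : (∃ λ b → b + b ≡ c + ā) → Shift a ā c
      shift-witness (b , 2b≡c+ā) = b , coprime-≈ (≈-sym a+2b≈c) N⊥c , N⊥ā+2b , ≈-sym a+2b≈c
        where
        a+2b≈c : a + (b + b) ≈ c [mod N ]
        a+2b≈c = begin
          a + (b + b)   ≡⟨ cong (a +_) 2b≡c+ā ⟩
          a + (c + ā)   ≡⟨ regroup a ā c ⟩
          c + (a + ā)   ≈⟨ +-congˡ c a+ā≈0 ⟩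
          c + 0         ≡⟨ +-identityʳ c ⟩
          c             ∎
          where
          open ≈-Reasoning N
          regroup : ∀ a ā c → a + (c + ā) ≡ c + (a + ā)
          regroup = solve-∀
        q∤ā+2b : ∀ {q} → q ∣ N → ¬ c ≈ a + a [mod q ] → ¬ q ∣ ā + (b + b)
        q∤ā+2b {q} q∣N c≉2a q∣ā+2b = c≉2a (begin
          c                           ≡⟨ +-identityʳ c ⟨
          c + 0                       ≈⟨ +-congˡ c (≈-divisor q∣N (+-cong a+ā≈0 a+ā≈0)) ⟨
          c + ((a + ā) + (a + ā))     ≡⟨ regroup a ā c ⟩
          ā + (c + ā) + (a + a)       ≡⟨ cong (λ t → ā + t + (a + a)) 2b≡c+ā ⟨
          ā + (b + b) + (a + a)       ≈⟨ +-congʳ (a + a) (∣⇒≈0 q∣ā+2b) ⟩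
          0 + (a + a)                 ∎)
          where
          open ≈-Reasoning q
          regroup : ∀ a ā c → c + ((a + ā) + (a + ā)) ≡ ā + (c + ā) + (a + a)
          regroup = solve-∀
        2∤ā+2b : ¬ 2 ∣ ā + (b + b)
        2∤ā+2b = ≈1⇒odd (≈-trans (≈-reflexive (cong (ā +_) 2b≡c+ā))
          (≈-trans (+-cong (odd⇒≈1 2∤ā) (+-cong (odd⇒≈1 2∤c) (odd⇒≈1 2∤ā))) (+-multiple 1 1)))
        N⊥ā+2b : Coprime N (ā + (b + b))
        N⊥ā+2b = ∤⇒coprime 2∤ā+2b (q∤ā+2b q₁∣N c≉2a₁) (q∤ā+2b q₂∣N c≉2a₂)

  ω^log-gen : ∀ {g} → IsGen p g → g ≈ ω ^ log g [mod p ]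
  ω^log-gen (g-unit , _) = ≈-sym (ω^log (InUnits⇒unit pp g-unit))

  ω^-* : ∀ {y z} u v → y ≈ ω ^ u [mod p ] → z ≈ ω ^ v [mod p ] → y * z ≈ ω ^ (u + v) [mod p ]
  ω^-* u v y≈ z≈ = ≈-trans (*-cong y≈ z≈) (≈-reflexive (sym (^-distribˡ-+-* ω u v)))

  exp-* : ∀ {y} u v → y ≈ ω ^ u [mod p ] → y * exp v ≈ ω ^ (u + v) [mod p ]
  exp-* u v y≈ = ω^-* u v y≈ (exp≈ v)

  module _ {g : ℕ} (G : IsGen p g) where

    private
      a : ℕ
      a = log g

    inv-exp-* : exp (inv a) * g ≈ 1 [mod p ]
    inv-exp-* = ≈-trans (ω^-* (inv a) a (exp≈ (inv a)) (ω^log-gen G))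
      (ω^-cong (≈-trans (≈-reflexive (+-comm (inv a) a)) (+-inv≈0 a)))

    isInv-exp-inv : IsInv p g (exp (inv a))
    isInv-exp-inv = exp-InUnits (inv a) , ≈⇒≡mod (≈-trans (≈-reflexive (*-comm g (exp (inv a)))) inv-exp-*)

    isInv⇒≈ : ∀ {h} → IsInv p g h → h ≈ ω ^ inv a [mod p ]
    isInv⇒≈ {h} (_ , gh≡1) = begin
      h                       ≡⟨ *-identityˡ h ⟨
      1 * h                   ≈⟨ *-congʳ h inv-exp-* ⟨
      exp (inv a) * g * h     ≡⟨ *-assoc (exp (inv a)) g h ⟩
      exp (inv a) * (g * h)   ≈⟨ *-congˡ (exp (inv a)) (≡mod⇒≈ gh≡1) ⟩
      exp (inv a) * 1         ≡⟨ *-identityʳ _ ⟩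
      exp (inv a)             ≈⟨ exp≈ (inv a) ⟩
      ω ^ inv a               ∎
      where open ≈-Reasoning p

  inRg⇐ : ∀ {g} a b → g ≈ ω ^ a [mod p ] → Coprime N (a + (b + b)) → InRg p g (exp (b + b))
  inRg⇐ {g} a b g≈ω^a N⊥a+2b =
    (exp-InUnits (b + b) , exp b , ≈⇒≡mod (≈-trans (ω^-* b b (exp≈ b) (exp≈ b)) (≈-sym (exp≈ (b + b))))) ,
    exp (a + (b + b)) , isGen-exp N⊥a+2b , ≈⇒≡mod (≈-trans (exp≈ (a + (b + b))) (≈-sym (exp-* a (b + b) g≈ω^a)))

  inRg⇒ : ∀ {g r} a → g ≈ ω ^ a [mod p ] → InRg p g r → ∃ λ b → r ≈ ω ^ (b + b) [mod p ] × Coprime N (a + (b + b))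
  inRg⇒ {g} {r} a g≈ω^a (((r-unit , y , yy≡r) , z , Gz , z≡gr)) =
    log y , r≈ω^2b , isGen⇒coprime Gz (≈-trans (≡mod⇒≈ z≡gr) (ω^-* a (log y + log y) g≈ω^a r≈ω^2b))
    where
    p∤y : ¬ p ∣ y
    p∤y p∣y = InUnits⇒unit pp r-unit (≈0⇒∣ (≈-trans (≈-sym (≡mod⇒≈ yy≡r)) (∣⇒≈0 (∣m⇒∣m*n y p∣y))))
    r≈ω^2b : r ≈ ω ^ (log y + log y) [mod p ]
    r≈ω^2b = ≈-trans (≈-sym (≡mod⇒≈ yy≡r)) (ω^-* (log y) (log y) (≈-sym (ω^log p∤y)) (≈-sym (ω^log p∤y)))

  module _ {g : ℕ} (G : IsGen p g) where

    private
      a : ℕ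
      a = log g

    inI⇐ : ∀ b → Coprime N (a + (b + b)) → Coprime N (inv a + (b + b)) → InI p g (exp (b + b))
    inI⇐ b N⊥a+2b N⊥ā+2b = inRg⇐ a b (ω^log-gen G) N⊥a+2b , exp (inv a) , isInv-exp-inv G , inRg⇐ (inv a) b (exp≈ (inv a)) N⊥ā+2b

    inI⇒ : ∀ {r} → InI p g r →
           ∃ λ b → r ≈ ω ^ (b + b) [mod p ] × Coprime N (a + (b + b)) × Coprime N (inv a + (b + b))
    inI⇒ (g-part , h , h-inv , h-part) =
      let b  , r≈ω^2b  , N⊥a+2b  = inRg⇒ a (ω^log-gen G) g-part
          b′ , r≈ω^2b′ , N⊥ā+2b′ = inRg⇒ (inv a) (isInv⇒≈ G h-inv) h-part
      in b , r≈ω^2b , N⊥a+2b , coprime-≈ (+-congˡ (inv a) (ω^-injective {b′ + b′} {b + b} (≈-trans (≈-sym r≈ω^2b′) r≈ω^2b))) N⊥ā+2b′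

  Excluded : ℕ → ℕ → Set
  Excluded g h = ∃[ r ] (InI p g r × (h ≡ g * r [mod p ] ⊎ (∃[ h′ ] (IsInv p g h′ × h ≡ h′ * r [mod p ]))))

  module _ {g h : ℕ} (G : IsGen p g) (H : IsGen p h) where

    private
      a c : ℕ
      a = log g
      c = log h

    excluded⇒ : Excluded g h → Shift a (inv a) c ⊎ Shift (inv a) a c
    excluded⇒ (r , r∈I , inj₁ h≡gr) =
      let b , r≈ω^2b , N⊥a+2b , N⊥ā+2b = inI⇒ G r∈I
      in inj₁ (b , N⊥a+2b , N⊥ā+2b , ω^-injective (≈-trans (≈-sym (ω^log-gen H))
           (≈-trans (≡mod⇒≈ h≡gr) (ω^-* a (b + b) (ω^log-gen G) r≈ω^2b))))
    excluded⇒ (r , r∈I , inj₂ (h′ , h′-inv , h≡h′r)) =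
      let b , r≈ω^2b , N⊥a+2b , N⊥ā+2b = inI⇒ G r∈I
      in inj₂ (b , N⊥ā+2b , N⊥a+2b , ω^-injective (≈-trans (≈-sym (ω^log-gen H))
           (≈-trans (≡mod⇒≈ h≡h′r) (ω^-* (inv a) (b + b) (isInv⇒≈ G h′-inv) r≈ω^2b))))

    excluded⇐ : Shift a (inv a) c ⊎ Shift (inv a) a c → Excluded g h
    excluded⇐ (inj₁ (b , N⊥a+2b , N⊥ā+2b , c≈a+2b)) =
      exp (b + b) , inI⇐ G b N⊥a+2b N⊥ā+2b ,
      inj₁ (≈⇒≡mod (≈-trans (ω^log-gen H) (≈-trans (ω^-cong c≈a+2b) (≈-sym (exp-* a (b + b) (ω^log-gen G))))))
    excluded⇐ (inj₂ (b , N⊥ā+2b , N⊥a+2b , c≈ā+2b)) =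
      exp (b + b) , inI⇐ G b N⊥a+2b N⊥ā+2b ,
      inj₂ (exp (inv a) , isInv-exp-inv G ,
            ≈⇒≡mod (≈-trans (ω^log-gen H) (≈-trans (ω^-cong c≈ā+2b) (≈-sym (exp-* (inv a) (b + b) (exp≈ (inv a)))))))

  private
    either : ∀ {P Q : Set} → Dec P → Dec Q → ¬ (¬ P × ¬ Q) → P ⊎ Q
    either (yes p) _       _      = inj₁ p
    either (no _)  (yes q) _      = inj₂ q
    either (no ¬p) (no ¬q) ¬¬p∨q = contradiction (¬p , ¬q) ¬¬p∨q

    2a+2ā≈0 : ∀ {q} a → q ∣ N → (a + a) + (inv a + inv a) ≈ 0 [mod q ]
    2a+2ā≈0 a q∣N = ≈-trans (≈-reflexive (regroup a (inv a))) (≈-divisor q∣N (+-cong (+-inv≈0 a) (+-inv≈0 a)))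
      where
      regroup : ∀ a ā → (a + a) + (ā + ā) ≡ (a + ā) + (a + ā)
      regroup = solve-∀

    2ā+2a≈0 : ∀ {q} a → q ∣ N → (inv a + inv a) + (a + a) ≈ 0 [mod q ]
    2ā+2a≈0 a q∣N = ≈-trans (≈-reflexive (+-comm (inv a + inv a) (a + a))) (2a+2ā≈0 a q∣N)

    ā+a≈0 : ∀ a → inv a + a ≈ 0 [mod N ]
    ā+a≈0 a = ≈-trans (≈-reflexive (+-comm (inv a) a)) (+-inv≈0 a)

    -- 2a ≡ -2a would force q ∣ 4a
    2a≉2ā : ∀ {q a} → Prime q → q ≢ 2 → q ∣ N → Coprime N a → ¬ a + a ≈ inv a + inv a [mod q ]
    2a≉2ā {q} {a} pq q≢2 q∣N N⊥a 2a≈2ā = [ q∤4 , coprime⇒∤ pq q∣N N⊥a ]′ (euclidsLemma 4 a pq q∣4a)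
      where
      q∤4 : ¬ q ∣ 4
      q∤4 q∣4 = q≢2 (prime∣prime pq prime[2] ([ id , id ]′ (euclidsLemma 2 2 pq q∣4)))
      four : ∀ a → 4 * a ≡ (a + a) + (a + a)
      four = solve-∀
      q∣4a : q ∣ 4 * a
      q∣4a = ≈0⇒∣ (≈-trans (≈-reflexive (four a)) (≈-trans (+-congʳ (a + a) 2a≈2ā) (2ā+2a≈0 a q∣N)))

  -- ℳ(ω ^ a) turns out to consist of the generators ω ^ c with c ≡ 2a modulo one of q₁, q₂
  -- and c ≡ -2a modulo the other
  Twisted : ℕ → ℕ → Set
  Twisted a c = (c ≈ a + a [mod q₁ ] × c ≈ inv a + inv a [mod q₂ ]) ⊎ (c ≈ inv a + inv a [mod q₁ ] × c ≈ a + a [mod q₂ ])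

  module _ {g h : ℕ} (G : IsGen p g) (H : IsGen p h) where

    private
      a c : ℕ
      a = log g
      c = log h
      N⊥a : Coprime N a
      N⊥a = isGen⇒coprime-log G
      N⊥c : Coprime N c
      N⊥c = isGen⇒coprime-log H
      2∤a : ¬ 2 ∣ a
      2∤a = coprime⇒∤ prime[2] 2∣N N⊥a

    inM⇒twisted : InM p g h → Twisted a c
    inM⇒twisted (_ , not-excluded) =
      combine (either (c ≈? a + a [mod q₁ ]) (c ≈? a + a [mod q₂ ]) no-shift)
              (either (c ≈? inv a + inv a [mod q₁ ]) (c ≈? inv a + inv a [mod q₂ ]) no-inverse-shift)
      where
      no-shift : ¬ (¬ c ≈ a + a [mod q₁ ] × ¬ c ≈ a + a [mod q₂ ])
      no-shift (c≉₁ , c≉₂) = not-excluded (excluded⇐ G H (inj₁ (shift⇐ a (inv a) (+-inv≈0 a) N⊥c (odd-inv 2∤a) c≉₁ c≉₂)))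
      no-inverse-shift : ¬ (¬ c ≈ inv a + inv a [mod q₁ ] × ¬ c ≈ inv a + inv a [mod q₂ ])
      no-inverse-shift (c≉₁ , c≉₂) = not-excluded (excluded⇐ G H (inj₂ (shift⇐ (inv a) a (ā+a≈0 a) N⊥c 2∤a c≉₁ c≉₂)))
      combine : c ≈ a + a [mod q₁ ] ⊎ c ≈ a + a [mod q₂ ] → c ≈ inv a + inv a [mod q₁ ] ⊎ c ≈ inv a + inv a [mod q₂ ] →
                Twisted a c
      combine (inj₁ c≈2a) (inj₁ c≈2ā) = contradiction (≈-trans (≈-sym c≈2a) c≈2ā) (2a≉2ā pq₁ q₁≢2 q₁∣N N⊥a)
      combine (inj₁ c≈2a) (inj₂ c≈2ā) = inj₁ (c≈2a , c≈2ā)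
      combine (inj₂ c≈2a) (inj₁ c≈2ā) = inj₂ (c≈2ā , c≈2a)
      combine (inj₂ c≈2a) (inj₂ c≈2ā) = contradiction (≈-trans (≈-sym c≈2a) c≈2ā) (2a≉2ā pq₂ q₂≢2 q₂∣N N⊥a)

    twisted⇒inM : Twisted a c → InM p g h
    twisted⇒inM twisted = H , λ excluded → [ not-shift twisted , not-inverse-shift twisted ]′ (excluded⇒ G H excluded)
      where
      not-shift : Twisted a c → ¬ Shift a (inv a) c
      not-shift (inj₁ (c≈2a , _)) shift = shift⇒≉ a (inv a) (+-inv≈0 a) pq₁ q₁∣N shift c≈2a
      not-shift (inj₂ (_ , c≈2a)) shift = shift⇒≉ a (inv a) (+-inv≈0 a) pq₂ q₂∣N shift c≈2a
      not-inverse-shift : Twisted a c → ¬ Shift (inv a) a c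
      not-inverse-shift (inj₁ (_ , c≈2ā)) shift = shift⇒≉ (inv a) a (ā+a≈0 a) pq₂ q₂∣N shift c≈2ā
      not-inverse-shift (inj₂ (c≈2ā , _)) shift = shift⇒≉ (inv a) a (ā+a≈0 a) pq₁ q₁∣N shift c≈2ā

  private
    q₁∣m : q₁ ∣ m
    q₁∣m = m∣m*n q₂

    q₂∣m : q₂ ∣ m
    q₂∣m = n∣m*n q₁

    q₁⊥q₂ : Coprime q₁ q₂
    q₁⊥q₂ = primes-coprime pq₁ pq₂ q₁≢q₂

    x*a≈2a : ∀ a → x * a ≈ a + a [mod q₁ ]
    x*a≈2a a = ≈-trans (*-congʳ a x≈2) (≈-reflexive (cong (a +_) (+-identityʳ a)))

    x*a≈2ā : ∀ a → x * a ≈ inv a + inv a [mod q₂ ]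
    x*a≈2ā a = +-cancelʳ (a + a) (≈-trans (≈-reflexive (factor x a)) (≈-trans (*-congʳ a x+2≈0) (≈-sym (2ā+2a≈0 a q₂∣N))))
      where
      factor : ∀ x a → x * a + (a + a) ≡ (x + 2) * a
      factor = solve-∀

  twisted⇒≈± : ∀ {a c} → Twisted a c → c ≈± x * a [mod m ]
  twisted⇒≈± {a} {c} (inj₁ (c≈2a , c≈2ā)) = inj₁ (≈-*-coprime q₁⊥q₂ (≈-trans c≈2a (≈-sym (x*a≈2a a))) (≈-trans c≈2ā (≈-sym (x*a≈2ā a))))
  twisted⇒≈± {a} {c} (inj₂ (c≈2ā , c≈2a)) = inj₂ (≈-*-coprime q₁⊥q₂
    (≈-trans (+-congˡ c (x*a≈2a a)) (≈⇒+≈0 (2a+2ā≈0 a q₁∣N) c≈2ā))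
    (≈-trans (+-congˡ c (x*a≈2ā a)) (≈⇒+≈0 (2ā+2a≈0 a q₂∣N) c≈2a)))

  ≈±⇒twisted : ∀ {a c} → c ≈± x * a [mod m ] → Twisted a c
  ≈±⇒twisted {a} {c} (inj₁ c≈xa) = inj₁ (≈-trans (≈-divisor q₁∣m c≈xa) (x*a≈2a a) , ≈-trans (≈-divisor q₂∣m c≈xa) (x*a≈2ā a))
  ≈±⇒twisted {a} {c} (inj₂ c+xa≈0) = inj₂
    (+≈0⇒≈ (2a+2ā≈0 a q₁∣N) (≈-trans (+-congˡ c (≈-sym (x*a≈2a a))) (≈-divisor q₁∣m c+xa≈0)) ,
     +≈0⇒≈ (2ā+2a≈0 a q₂∣N) (≈-trans (+-congˡ c (≈-sym (x*a≈2ā a))) (≈-divisor q₂∣m c+xa≈0)))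

  module _ {g h : ℕ} (G : IsGen p g) (H : IsGen p h) where

    inM⇒≈± : InM p g h → log h ≈± x * log g [mod m ]
    inM⇒≈± = twisted⇒≈± ∘ inM⇒twisted G H

    ≈±⇒inM : log h ≈± x * log g [mod m ] → InM p g h
    ≈±⇒inM = twisted⇒inM G H ∘ ≈±⇒twisted

  private
    N⊥x : Coprime N x
    N⊥x = ∤⇒coprime 2∤x q₁∤x q₂∤x
      where
      q₁∤x : ¬ q₁ ∣ x
      q₁∤x q₁∣x = q₁≢2 (prime∣prime pq₁ prime[2] (≈0⇒∣ (≈-trans (≈-sym x≈2) (∣⇒≈0 q₁∣x))))
      q₂∤x : ¬ q₂ ∣ x
      q₂∤x q₂∣x = q₂≢2 (prime∣prime pq₂ prime[2] (≈0⇒∣ (≈-trans (≈-sym (+-congʳ 2 (∣⇒≈0 q₂∣x))) x+2≈0)))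

    N⊥x* : ∀ {a} → Coprime N a → Coprime N (x * a)
    N⊥x* N⊥a = Coprimality.sym (coprime-*ˡ (Coprimality.sym N⊥x) (Coprimality.sym N⊥a))

    N⊥x^ : ∀ k → Coprime N (x ^ k)
    N⊥x^ k = Coprimality.sym (coprime-^ˡ (Coprimality.sym N⊥x) k)

    -- x⁻¹ inverts x modulo m, by Fermat modulo q₁ and q₂
    E : ℕ
    E = (q₁ ∸ 1) * (q₂ ∸ 1)

    x^E≈1 : x ^ E ≈ 1 [mod m ]
    x^E≈1 = ≈-*-coprime q₁⊥q₂
      (≈-trans (≈-reflexive (sym (^-*-assoc x (q₁ ∸ 1) (q₂ ∸ 1)))) (≈-trans (^-congˡ (q₂ ∸ 1) (fermat pq₁ (coprime⇒∤ pq₁ q₁∣N N⊥x))) (≈-reflexive (^-zeroˡ (q₂ ∸ 1)))))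
      (≈-trans (≈-reflexive (trans (cong (x ^_) (*-comm (q₁ ∸ 1) (q₂ ∸ 1))) (sym (^-*-assoc x (q₂ ∸ 1) (q₁ ∸ 1)))))
        (≈-trans (^-congˡ (q₁ ∸ 1) (fermat pq₂ (coprime⇒∤ pq₂ q₂∣N N⊥x))) (≈-reflexive (^-zeroˡ (q₁ ∸ 1)))))

    x⁻¹ : ℕ
    x⁻¹ = x ^ (E ∸ 1)

    x⁻¹*x≈1 : x⁻¹ * x ≈ 1 [mod m ]
    x⁻¹*x≈1 = ≈-trans (≈-reflexive (trans (*-comm x⁻¹ x) (cong (x ^_) (trans (+-comm 1 (E ∸ 1)) (m∸n+n≡m 1≤E))))) x^E≈1
      where
      1≤E : 1 ≤ E
      1≤E = *-mono-≤ (1≤p∸1 pq₁) (1≤p∸1 pq₂)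

    x⁻¹-cancel : ∀ u → x⁻¹ * (x * u) ≈ u [mod m ]
    x⁻¹-cancel u = ≈-trans (≈-reflexive (sym (*-assoc x⁻¹ x u))) (≈-trans (*-congʳ u x⁻¹*x≈1) (≈-reflexive (*-identityˡ u)))

  ≈±-cancel-x : ∀ {u v} → x * u ≈± x * v [mod m ] → u ≈± v [mod m ]
  ≈±-cancel-x {u} {v} xu≈±xv = ≈±-resp (x⁻¹-cancel u) (x⁻¹-cancel v) (≈±-*-congˡ x⁻¹ xu≈±xv)

  log-exp-m : ∀ u → log (exp u) ≈ u [mod m ]
  log-exp-m u = ≈-divisor m∣N (log-exp u)

  successor : ℕ → ℕ
  successor g = exp (x * log g)

  module _ {g : ℕ} (G : IsGen p g) where

    isGen-successor : IsGen p (successor g)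
    isGen-successor = isGen-exp (N⊥x* (isGen⇒coprime-log G))

    inM-successor : InM p g (successor g)
    inM-successor = ≈±⇒inM G isGen-successor (inj₁ (log-exp-m (x * log g)))

  module _ {g g′ : ℕ} (G : IsGen p g) (G′ : IsGen p g′) where

    sameM⇒≈± : SameM p g g′ → log g ≈± log g′ [mod m ]
    sameM⇒≈± same = ≈±-cancel-x (≈±-trans (≈±-sym (inM⇒≈± G (isGen-successor G) (inM-successor G)))
                                           (inM⇒≈± G′ (isGen-successor G) (proj₁ (same (successor g)) (inM-successor G))))

    ≈±⇒sameM : log g ≈± log g′ [mod m ] → SameM p g g′
    ≈±⇒sameM g≈±g′ y = (λ y∈M[g] → ≈±⇒inM G′ (proj₁ y∈M[g]) (≈±-trans (inM⇒≈± G (proj₁ y∈M[g]) y∈M[g]) (≈±-*-congˡ x g≈±g′)))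
                     , (λ y∈M[g′] → ≈±⇒inM G (proj₁ y∈M[g′]) (≈±-trans (inM⇒≈± G′ (proj₁ y∈M[g′]) y∈M[g′]) (≈±-*-congˡ x (≈±-sym g≈±g′))))

  edge⇒≈± : ∀ {g h} → Edge p g h → log h ≈± x * log g [mod m ]
  edge⇒≈± (G , H , h′ , H′ , h′∼h , h′∈M[g]) = ≈±-trans (≈±-sym (sameM⇒≈± H′ H h′∼h)) (inM⇒≈± G H′ h′∈M[g])

  sameM-isEquivalence : IsEquivalence (SameM p)
  sameM-isEquivalence = record
    { refl  = λ _ → id , id
    ; sym   = λ g∼h y → proj₂ (g∼h y) , proj₁ (g∼h y)
    ; trans = λ g∼h h∼k y → proj₁ (h∼k y) ∘ proj₁ (g∼h y) , proj₂ (g∼h y) ∘ proj₂ (h∼k y)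
    }

  orbit : ℕ → ℕ
  orbit k = exp (x ^ k)

  isGen-orbit : ∀ k → IsGen p (orbit k)
  isGen-orbit k = isGen-exp (N⊥x^ k)

  orbit-sameM⇒ : ∀ {i j} → SameM p (orbit i) (orbit j) → x ^ i ≈± x ^ j [mod m ]
  orbit-sameM⇒ {i} {j} same = ≈±-resp (log-exp-m (x ^ i)) (log-exp-m (x ^ j)) (sameM⇒≈± (isGen-orbit i) (isGen-orbit j) same)

  orbit-sameM⇐ : ∀ {i j} → x ^ i ≈± x ^ j [mod m ] → SameM p (orbit i) (orbit j)
  orbit-sameM⇐ {i} {j} e = ≈±⇒sameM (isGen-orbit i) (isGen-orbit j) (≈±-resp (≈-sym (log-exp-m (x ^ i))) (≈-sym (log-exp-m (x ^ j))) e)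

  orbit-edge : ∀ k → Edge p (orbit k) (orbit (suc k))
  orbit-edge k = isGen-orbit k , isGen-orbit (suc k) , orbit (suc k) , isGen-orbit (suc k) , (λ _ → id , id) ,
    ≈±⇒inM (isGen-orbit k) (isGen-orbit (suc k)) (inj₁ (≈-trans (log-exp-m (x ^ suc k)) (*-congˡ x (≈-sym (log-exp-m (x ^ k))))))

  conn-orbit : ∀ k → Conn p (orbit 0) (orbit k)
  conn-orbit zero    = ε
  conn-orbit (suc k) = conn-orbit k ◅◅ (fwd (orbit-edge k) ◅ ε)

  Reaches : ℕ → Set
  Reaches h = IsGen p h → ∃ λ k → log h ≈± x ^ k [mod m ]

  step-reaches : ∀ {g h} → SymClosure (Edge p) g h → Reaches g → Reaches h
  step-reaches (fwd g→h) g-reaches _ =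
    let k , g≈±x^k = g-reaches (proj₁ g→h) in suc k , ≈±-trans (edge⇒≈± g→h) (≈±-*-congˡ x g≈±x^k)
  step-reaches {g} {h} (bwd h→g) g-reaches _ =
    let k , g≈±x^k = g-reaches (proj₁ (proj₂ h→g))
    in E ∸ 1 + k , ≈±-trans (≈±-resp (x⁻¹-cancel (log h)) ≈-refl (≈±-*-congˡ x⁻¹ (≈±-sym (edge⇒≈± h→g))))
                            (≈±-resp ≈-refl (≈-reflexive (sym (^-distribˡ-+-* x (E ∸ 1) k))) (≈±-*-congˡ x⁻¹ g≈±x^k))

  conn-reaches : ∀ {g h} → Conn p g h → Reaches g → Reaches h
  conn-reaches ε             = id
  conn-reaches (s ◅ g⇝h) = conn-reaches g⇝h ∘ step-reaches s

  component-length : ∀ {n} → ComponentSize p (orbit 0) n → x ^ n ≈± 1 [mod m ]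
  component-length (hs , members , distinct , covers , refl) =
    ≈±-sym (orbit-sameM⇒ {0} {length hs} (orbit-length hs distinct covers′ (All.map in-orbit members)))
    where
    open Orbit sameM-isEquivalence orbit
      (λ {i} {j} same → orbit-sameM⇐ {suc i} {suc j} (≈±-*-congˡ x (orbit-sameM⇒ {i} {j} same)))
      (λ {i} {j} same → orbit-sameM⇐ {i} {j} (≈±-cancel-x (orbit-sameM⇒ {suc i} {suc j} same)))
    reaches₀ : Reaches (orbit 0)
    reaches₀ _ = 0 , ≈⇒≈± (log-exp-m 1)
    covers′ : ∀ k → Any (SameM p (orbit k)) hs
    covers′ k = covers (orbit k) (isGen-orbit k) (conn-orbit k)
    in-orbit : ∀ {h} → IsGen p h × Conn p (orbit 0) h → ∃ λ k → SameM p h (orbit k)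
    in-orbit {h} (H , C) = in-orbit′ (conn-reaches C reaches₀ H)
      where
      in-orbit′ : (∃ λ k → log h ≈± x ^ k [mod m ]) → ∃ λ k → SameM p h (orbit k)
      in-orbit′ (k , h≈±x^k) = k , ≈±⇒sameM H (isGen-orbit k) (≈±-trans h≈±x^k (≈⇒≈± (≈-sym (log-exp-m (x ^ k)))))

module _ {m x : ℕ} (x²≈4 : x * x ≈ 4 [mod m ]) where

  private
    ^-double : ∀ a t → a ^ (t + t) ≡ (a * a) ^ t
    ^-double a t = trans (^-distribˡ-+-* a t t) (sym (*-^ a a t))

    x^[t+t]≈4^t : ∀ t → x ^ (t + t) ≈ 4 ^ t [mod m ]
    x^[t+t]≈4^t t = ≈-trans (≈-reflexive (^-double x t)) (^-congˡ t x²≈4)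

  even-exponent : ∀ t → x ^ (t + t) ≈± 1 [mod m ] → 2 ^ (t + t) ≈± 1 [mod m ]
  even-exponent t = ≈±-resp (≈-trans (x^[t+t]≈4^t t) (≈-reflexive (sym (^-double 2 t)))) ≈-refl

  odd-exponent : ∀ {y} t → x * y ≈ 1 [mod m ] → x ^ suc (2 * t) ≈± 1 [mod m ] → 2 ^ (2 * t) ≈± y [mod m ]
  odd-exponent {y} t xy≈1 x^[1+2t]≈±1 = ≈±-resp 4^t*[xy]≈4^t (≈-reflexive (*-identityˡ y)) (≈±-*-cong x*4^t≈±1 (≈±-refl {a = y}))
    where
    2t≡t+t : 2 * t ≡ t + t
    2t≡t+t = cong (t +_) (+-identityʳ t)
    x*4^t≈±1 : x * 4 ^ t ≈± 1 [mod m ]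
    x*4^t≈±1 = ≈±-resp (*-congˡ x (≈-trans (≈-reflexive (cong (x ^_) 2t≡t+t)) (x^[t+t]≈4^t t))) ≈-refl x^[1+2t]≈±1
    4^t*[xy]≈4^t : x * 4 ^ t * y ≈ 2 ^ (2 * t) [mod m ]
    4^t*[xy]≈4^t = begin
      x * 4 ^ t * y     ≡⟨ trans (cong (_* y) (*-comm x (4 ^ t))) (*-assoc (4 ^ t) x y) ⟩
      4 ^ t * (x * y)   ≈⟨ *-congˡ (4 ^ t) xy≈1 ⟩
      4 ^ t * 1         ≡⟨ *-identityʳ (4 ^ t) ⟩
      4 ^ t             ≡⟨ trans (sym (^-double 2 t)) (cong (2 ^_) (sym 2t≡t+t)) ⟩
      2 ^ (2 * t)       ∎
      where open ≈-Reasoning m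

private
  odd⇒∤ : ∀ {k} → Odd k → ¬ 2 ∣ k
  odd⇒∤ (t , refl) = ≈1⇒odd (subst (λ u → suc u ≈ 1 [mod 2 ]) (*-comm t 2) (+-multiple 1 t))

  ∤⇒≢2 : ∀ {q} → ¬ 2 ∣ q → q ≢ 2
  ∤⇒≢2 2∤q refl = 2∤q ∣-refl

  even-or-odd : ∀ n → (∃ λ t → n ≡ t + t) ⊎ Odd n
  even-or-odd zero    = inj₁ (0 , refl)
  even-or-odd (suc n) = [ (λ (t , n≡t+t) → inj₂ (t , cong suc (trans n≡t+t (cong (t +_) (sym (+-identityʳ t))))))
                        , (λ (t , n≡1+2t) → inj₁ (suc t , cong suc (trans n≡1+2t (trans (cong (λ u → suc (t + u)) (+-identityʳ t)) (sym (+-suc t t))))))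
                        ]′ (even-or-odd n)

  ≈±⇒≡mod : ∀ {u v m} → u ≈± v [mod m ] → u ≡ v [mod m ] ⊎ u + v ≡ 0 [mod m ]
  ≈±⇒≡mod = map ≈⇒≡mod ≈⇒≡mod

-- Square roots of 4 modulo q₁ q₂

MixedRoot : ℕ → ℕ → ℕ → Set
MixedRoot q₁ q₂ x = (x ≈ 2 [mod q₁ ] × x + 2 ≈ 0 [mod q₂ ]) ⊎ (x + 2 ≈ 0 [mod q₁ ] × x ≈ 2 [mod q₂ ])

module _ {p q₁ q₂ i j₁ j₂ n : ℕ} (pp : Prime p) (pq₁ : Prime q₁) (pq₂ : Prime q₂)
  (q₁≢q₂ : q₁ ≢ q₂) (q₁≢2 : q₁ ≢ 2) (q₂≢2 : q₂ ≢ 2)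
  (N≡ : p ∸ 1 ≡ 2 ^ suc i * q₁ ^ suc j₁ * q₂ ^ suc j₂)
  (components : ∀ g → IsGen p g → ComponentSize p g n) where

  -- for a root of the second kind, swap the roles of q₁ and q₂
  mixedRoot^n≈±1 : ∀ {x} → ¬ 2 ∣ x → MixedRoot q₁ q₂ x → x ^ n ≈± 1 [mod q₁ * q₂ ]
  mixedRoot^n≈±1 2∤x (inj₁ (x≈2 , x+2≈0)) =
    let open MissingGenerators {i = i} {j₁} {j₂} pp pq₁ pq₂ q₁≢q₂ q₁≢2 q₂≢2 N≡ 2∤x x≈2 x+2≈0
    in component-length (components (orbit 0) (isGen-orbit 0))
  mixedRoot^n≈±1 {x} 2∤x (inj₂ (x+2≈0 , x≈2)) =
    let open MissingGenerators {i = i} {j₂} {j₁} pp pq₂ pq₁ (q₁≢q₂ ∘ sym) q₂≢2 q₁≢2 (trans N≡ (swap (2 ^ suc i) (q₁ ^ suc j₁) (q₂ ^ suc j₂))) 2∤x x≈2 x+2≈0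
    in subst (λ m → x ^ n ≈± 1 [mod m ]) (*-comm q₂ q₁) (component-length (components (orbit 0) (isGen-orbit 0)))
    where
    swap : ∀ a b c → a * b * c ≡ a * c * b
    swap = solve-∀

module _ {q₁ q₂ : ℕ} (pq₁ : Prime q₁) (pq₂ : Prime q₂) (q₁≢q₂ : q₁ ≢ q₂) where

  private
    m : ℕ
    m = q₁ * q₂

    q₁⊥q₂ : Coprime q₁ q₂
    q₁⊥q₂ = primes-coprime pq₁ pq₂ q₁≢q₂

    4≤m : 4 ≤ m
    4≤m = *-mono-≤ (nonTrivial⇒n>1 q₁ {{prime⇒nonTrivial pq₁}}) (nonTrivial⇒n>1 q₂ {{prime⇒nonTrivial pq₂}})

  mixedRoot⇒square≈4 : ∀ {x} → MixedRoot q₁ q₂ x → x * x ≈ 4 [mod m ]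
  mixedRoot⇒square≈4 (inj₁ (x≈2 , x+2≈0)) = ≈-*-coprime q₁⊥q₂ (≈±⇒*≈* (inj₁ x≈2)) (≈±⇒*≈* (inj₂ x+2≈0))
  mixedRoot⇒square≈4 (inj₂ (x+2≈0 , x≈2)) = ≈-*-coprime q₁⊥q₂ (≈±⇒*≈* (inj₂ x+2≈0)) (≈±⇒*≈* (inj₁ x≈2))

  -- modulo each qᵢ a square root of 4 is ±2; equal signs give 2 or m - 2 by the Chinese remainder theorem
  square≈4⇒mixedRoot : ∀ {x} → x < m → x * x ≈ 4 [mod m ] → x ≢ 2 → x ≢ m ∸ 2 → MixedRoot q₁ q₂ x
  square≈4⇒mixedRoot {x} x<m x²≈4 x≢2 x≢m∸2 =
    signs (*≈*⇒≈± pq₁ (≈-divisor (m∣m*n q₂) x²≈4)) (*≈*⇒≈± pq₂ (≈-divisor (n∣m*n q₁) x²≈4))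
    where
    m∸2+2≈0 : m ∸ 2 + 2 ≈ 0 [mod m ]
    m∸2+2≈0 = ≈-trans (≈-reflexive (m∸n+n≡m (≤-trans (s≤s (s≤s z≤n)) 4≤m))) (∣⇒≈0 (∣-refl {m}))
    m∸2<m : m ∸ 2 < m
    m∸2<m = ∸-monoʳ-< {m} {2} {0} z<s (≤-trans (s≤s (s≤s z≤n)) 4≤m)
    signs : x ≈± 2 [mod q₁ ] → x ≈± 2 [mod q₂ ] → MixedRoot q₁ q₂ x
    signs (inj₁ x≈2) (inj₁ x≈2′) = contradiction (≈∧<⇒≡ x<m (≤-trans (s≤s (s≤s (s≤s z≤n))) 4≤m) (≈-*-coprime q₁⊥q₂ x≈2 x≈2′)) x≢2
    signs (inj₁ x≈2) (inj₂ x+2≈0) = inj₁ (x≈2 , x+2≈0)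
    signs (inj₂ x+2≈0) (inj₁ x≈2) = inj₂ (x+2≈0 , x≈2)
    signs (inj₂ x+2≈0) (inj₂ x+2≈0′) =
      contradiction (≈∧<⇒≡ x<m m∸2<m (+-cancelʳ 2 (≈-trans (≈-*-coprime q₁⊥q₂ x+2≈0 x+2≈0′) (≈-sym m∸2+2≈0)))) x≢m∸2

  private
    2+4t : ∀ {q q′} t → t ≈ 0 [mod q ] → t + 1 ≈ 0 [mod q′ ] → 2 + 4 * t ≈ 2 [mod q ] × 2 + 4 * t + 2 ≈ 0 [mod q′ ]
    2+4t t t≈0 t+1≈0 = +-congˡ 2 (*-congˡ 4 t≈0) , ≈-trans (≈-reflexive (factor t)) (*-congˡ 4 t+1≈0)
      where
      factor : ∀ t → 2 + 4 * t + 2 ≡ 4 * (t + 1)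
      factor = solve-∀

    even : ∀ t → 2 ∣ 2 + 4 * t
    even t = divides (1 + 2 * t) (twice t)
      where
      twice : ∀ t → 2 + 4 * t ≡ (1 + 2 * t) * 2
      twice = solve-∀

    -- Bézout gives t ≡ 0 modulo one qᵢ and t ≡ -1 modulo the other; 2 + 4t is then a mixed root
    ∃-even-mixedRoot : ∃ λ x → 2 ∣ x × MixedRoot q₁ q₂ x
    ∃-even-mixedRoot with coprime-Bézout q₁⊥q₂
    ... | Bézout.+- a b 1+bq₂≡aq₁ =
      let q₂-part , q₁-part = 2+4t (b * q₂) (∣⇒≈0 (divides b refl)) (∣⇒≈0 (divides a (trans (+-comm (b * q₂) 1) 1+bq₂≡aq₁)))
      in 2 + 4 * (b * q₂) , even (b * q₂) , inj₂ (q₁-part , q₂-part)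
    ... | Bézout.-+ a b 1+aq₁≡bq₂ =
      let q₁-part , q₂-part = 2+4t (a * q₁) (∣⇒≈0 (divides a refl)) (∣⇒≈0 (divides b (trans (+-comm (a * q₁) 1) 1+aq₁≡bq₂)))
      in 2 + 4 * (a * q₁) , even (a * q₁) , inj₁ (q₁-part , q₂-part)

  ∃-odd-mixedRoot : ¬ 2 ∣ q₁ → ¬ 2 ∣ q₂ → ∃ λ x → ¬ 2 ∣ x × MixedRoot q₁ q₂ x
  ∃-odd-mixedRoot 2∤q₁ 2∤q₂ =
    let x , 2∣x , mixed = ∃-even-mixedRoot
    in x + m , ≈1⇒odd (+-cong (∣⇒≈0 2∣x) (*-cong (odd⇒≈1 2∤q₁) (odd⇒≈1 2∤q₂))) , shift mixed
    where
    +m≈₁ : ∀ x → x + m ≈ x [mod q₁ ]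
    +m≈₁ x = subst (λ k → x + k ≈ x [mod q₁ ]) (*-comm q₂ q₁) (+-multiple x q₂)
    +m≈₂ : ∀ x → x + m ≈ x [mod q₂ ]
    +m≈₂ x = +-multiple x q₁
    shift : ∀ {x} → MixedRoot q₁ q₂ x → MixedRoot q₁ q₂ (x + m)
    shift {x} (inj₁ (x≈2 , x+2≈0)) = inj₁ (≈-trans (+m≈₁ x) x≈2 , ≈-trans (+-congʳ 2 (+m≈₂ x)) x+2≈0)
    shift {x} (inj₂ (x+2≈0 , x≈2)) = inj₂ (≈-trans (+-congʳ 2 (+m≈₁ x)) x+2≈0 , ≈-trans (+m≈₂ x) x≈2)

  module _ {n : ℕ} (mixedRoot^n≈±1 : ∀ {x} → ¬ 2 ∣ x → MixedRoot q₁ q₂ x → x ^ n ≈± 1 [mod m ]) where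

    2^n≈±1 : ¬ 2 ∣ q₁ → ¬ 2 ∣ q₂ → ¬ Odd n → 2 ^ n ≈± 1 [mod m ]
    2^n≈±1 2∤q₁ 2∤q₂ n-even =
      let x , 2∤x , mixed = ∃-odd-mixedRoot 2∤q₁ 2∤q₂
      in [ (λ (t , n≡t+t) → subst (λ k → 2 ^ k ≈± 1 [mod m ]) (sym n≡t+t)
             (even-exponent {x = x} (mixedRoot⇒square≈4 mixed) t (subst (λ k → x ^ k ≈± 1 [mod m ]) n≡t+t (mixedRoot^n≈±1 2∤x mixed))))
         , (λ n-odd → contradiction n-odd n-even) ]′ (even-or-odd n)

    2^[n∸1]≈±y : ∀ {x₁ y} → Odd n → x₁ < m → x₁ * x₁ ≈ 4 [mod m ] → x₁ ≢ 2 → x₁ ≢ m ∸ 2 → ¬ 2 ∣ x₁ →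
                 x₁ * y ≈ 1 [mod m ] → 2 ^ (n ∸ 1) ≈± y [mod m ]
    2^[n∸1]≈±y {x₁} {y} (t , n≡1+2t) x₁<m x₁²≈4 x₁≢2 x₁≢m∸2 2∤x₁ x₁y≈1 =
      subst (λ k → 2 ^ (k ∸ 1) ≈± y [mod m ]) (sym n≡1+2t)
        (odd-exponent {x = x₁} x₁²≈4 t x₁y≈1 (subst (λ k → x₁ ^ k ≈± 1 [mod m ]) n≡1+2t
          (mixedRoot^n≈±1 2∤x₁ (square≈4⇒mixedRoot x₁<m x₁²≈4 x₁≢2 x₁≢m∸2))))

lemma7 : (p q₁ q₂ i j₁ j₂ n : ℕ) →
    Prime p → Prime q₁ → Prime q₂ → q₁ ≢ q₂ → Odd q₁ → Odd q₂ →
    1 ≤ i → 1 ≤ j₁ → 1 ≤ j₂ →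
    p ∸ 1 ≡ 2 ^ i * q₁ ^ j₁ * q₂ ^ j₂ →
    (∀ g → IsGen p g → ComponentSize p g n) →
    (¬ Odd n → (2 ^ n ≡ 1 [mod q₁ * q₂ ] ⊎ 2 ^ n + 1 ≡ 0 [mod q₁ * q₂ ]))
    × (Odd n →
        ∀ x₁ → 1 ≤ x₁ → x₁ < q₁ * q₂ → x₁ * x₁ ≡ 4 [mod q₁ * q₂ ] →
        x₁ ≢ 2 → x₁ ≢ q₁ * q₂ ∸ 2 → Odd x₁ →
        ∀ y → x₁ * y ≡ 1 [mod q₁ * q₂ ] →
        (2 ^ (n ∸ 1) ≡ y [mod q₁ * q₂ ] ⊎ 2 ^ (n ∸ 1) + y ≡ 0 [mod q₁ * q₂ ]))
lemma7 p q₁ q₂ (suc i) (suc j₁) (suc j₂) n pp pq₁ pq₂ q₁≢q₂ odd-q₁ odd-q₂ _ _ _ N≡ components =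
    (λ n-even → ≈±⇒≡mod (2^n≈±1 pq₁ pq₂ q₁≢q₂ x^n≈±1 2∤q₁ 2∤q₂ n-even))
  , (λ n-odd x₁ _ x₁<m x₁²≡4 x₁≢2 x₁≢m∸2 odd-x₁ y x₁y≡1 → ≈±⇒≡mod
       (2^[n∸1]≈±y pq₁ pq₂ q₁≢q₂ x^n≈±1 n-odd x₁<m (≡mod⇒≈ x₁²≡4) x₁≢2 x₁≢m∸2 (odd⇒∤ odd-x₁) (≡mod⇒≈ x₁y≡1)))
  where
  2∤q₁ : ¬ 2 ∣ q₁
  2∤q₁ = odd⇒∤ odd-q₁
  2∤q₂ : ¬ 2 ∣ q₂
  2∤q₂ = odd⇒∤ odd-q₂
  x^n≈±1 : ∀ {x} → ¬ 2 ∣ x → MixedRoot q₁ q₂ x → x ^ n ≈± 1 [mod q₁ * q₂ ]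
  x^n≈±1 = mixedRoot^n≈±1 {i = i} {j₁} {j₂} pp pq₁ pq₂ q₁≢q₂ (∤⇒≢2 2∤q₁) (∤⇒≢2 2∤q₂) N≡ components
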